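{- Let $n\ge m\ge 2$. Then $$\mu_{\rm o}(P_n\,\square\,P_m)=\begin{cases}2, & m=n=2,\\ 4, & (n,m)\in\{(3,2),(3,3),(4,3),(4,4)\},\\ 5, & (n,m)\in\{(5,4),(5,5),(6,4)\},\\ 6, & n=6,\ m=5,\\ m+2, & \text{otherwise}.\end{cases}$$
   Context: The grid graph $P_n\,\square\,P_m$ has vertex set $[n]\times[m]$, with $(i,j)$ adjacent to $(k,\ell)$ iff $|i-k|+|j-\ell|=1$. For a graph $G$ and $X\subseteq V(G)$, vertices $u,v\in V(G)$ are $X$-visible if there exists a shortest $u,v$-path $P$ with $V(P)\cap X\subseteq\{u,v\}$. $X$ is an outer mutual-visibility set if every two vertices of $X$ are $X$-visible and every $u\in X$, $v\in V(G)\setminus X$ are $X$-visible; $\mu_{\rm o}(G)$ is the maximum cardinality of an outer mutual-visibility set of $G$. -}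

module Defs where

open import Data.Nat using (ℕ; zero; suc; _+_; _≤_; ∣_-_∣)
open import Data.Fin using (Fin; toℕ)
open import Data.Product using (_×_; _,_; Σ; ∃-syntax)
open import Data.Sum using (_⊎_)
open import Data.List using (List; []; _∷_; length)
open import Data.List.Membership.Propositional using (_∈_; _∉_)
open import Data.List.Relation.Unary.Unique.Propositional using (Unique)
open import Relation.Binary.PropositionalEquality using (_≡_)

record Graph : Set₁ where
  field
    Vertex : Set
    Adj    : Vertex → Vertex → Set

module _ (G : Graph) where
  open Graph G

  data Walk : Vertex → Vertex → Set where
    []  : ∀ {u} → Walk u u
    _∷_ : ∀ {u w v} → Adj u w → Walk w v → Walk u v

  walkLength : ∀ {u v} → Walk u v → ℕ
  walkLength []      = 0
  walkLength (_ ∷ p) = suc (walkLength p)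

  walkVertices : ∀ {u v} → Walk u v → List Vertex
  walkVertices {u} []      = u ∷ []
  walkVertices {u} (_ ∷ p) = u ∷ walkVertices p

  IsShortest : ∀ {u v} → Walk u v → Set
  IsShortest {u} {v} p = ∀ (q : Walk u v) → walkLength p ≤ walkLength q

  Visible : List Vertex → Vertex → Vertex → Set
  Visible X u v =
    Σ (Walk u v) λ p → IsShortest p ×
      (∀ x → x ∈ walkVertices p → x ∈ X → (x ≡ u) ⊎ (x ≡ v))

  IsOuterMV : List Vertex → Set
  IsOuterMV X =
    Unique X ×
    ((∀ u v → u ∈ X → v ∈ X → Visible X u v) ×
     (∀ u v → u ∈ X → v ∉ X → Visible X u v))

  OuterMVNumber : ℕ → Set
  OuterMVNumber k =
    (∃[ X ] (IsOuterMV X × length X ≡ k)) ×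
    (∀ X → IsOuterMV X → length X ≤ k)

Grid : ℕ → ℕ → Graph
Grid n m = record
  { Vertex = Fin n × Fin m
  ; Adj    = λ { (i , j) (k , l) → ∣ toℕ i - toℕ k ∣ + ∣ toℕ j - toℕ l ∣ ≡ 1 }
  }

muoGrid : ℕ → ℕ → ℕ
muoGrid 2 2 = 2
muoGrid 3 2 = 4
muoGrid 3 3 = 4
muoGrid 4 3 = 4
muoGrid 4 4 = 4
muoGrid 5 4 = 5
muoGrid 5 5 = 5
muoGrid 6 4 = 5
muoGrid 6 5 = 6
muoGrid n m = m + 2

-- Shortest paths in a grid are exactly the monotone staircase walks, so u and v are
-- X-visible iff some staircase from u to v meets X only at its ends. If two vertices of X
-- share a row, the neighbour of one of them on the far side must see the other through it,
-- so both lie in the border columns (and likewise for columns). Hence a row carries one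
-- vertex of X or a (first, last) pair, and by the column condition at most two rows carry
-- pairs: |X| ≤ m + 2. Conversely, if X also has no two diagonally adjacent vertices, a
-- staircase around X can always be routed, so the four corners together with one vertex in
-- each inner row, in columns that are interior and differ by at least 2 between adjacent
-- rows, form an outer mutual-visibility set of size m + 2 as soon as the grid is wide enough.
-- The few small grids where this fails are settled by a search over all row profiles.

module Submission where

open import Defs
open import Data.Bool using (Bool; true; false; _∧_; _∨_; not; T)
open import Data.Bool.ListAction using (any; all)
open import Data.Bool.Properties using (T-∧; T-∨)
open import Data.Empty using (⊥; ⊥-elim)
open import Data.Fin as Fin using (Fin; toℕ; fromℕ<; #_)
open import Data.Fin.Properties
  using (toℕ<n; toℕ-injective; toℕ-inject₁; toℕ-fromℕ; toℕ-fromℕ<; opposite-prop; opposite-involutive; injective⇒≤; any?)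
open import Data.List as List using (List; []; _∷_; length; _++_; map; concatMap; allFin; cartesianProduct)
open import Data.List.Membership.Propositional using (_∈_; _∉_)
open import Data.List.Membership.Propositional.Properties
  using (∈-lookup; ∈-++⁻; ∈-map⁺; ∈-map⁻; ∈-allFin; ∈-concatMap⁺; ∈-concatMap⁻)
open import Data.List.Relation.Unary.All as All using ([]; _∷_)
open import Data.List.Relation.Unary.All.Properties using (all⁺; all⁻)
open import Data.List.Relation.Unary.AllPairs using ([]; _∷_)
open import Data.List.Relation.Unary.Any as Any using (Any; here; there; index)
open import Data.List.Relation.Unary.Any.Properties using (any⁺; lookup-index)
open import Data.List.Relation.Unary.Unique.Propositional using (Unique)
open import Data.List.Relation.Unary.Unique.Propositional.Properties using (++⁺)
open import Data.Nat
  using (ℕ; zero; suc; pred; _+_; _∸_; _≤_; _≰_; _<_; z≤n; s≤s; s≤s⁻¹; ∣_-_∣; ⌊_/2⌋; _≤?_; _≟_; _≡ᵇ_; _<ᵇ_; _≤ᵇ_)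
open import Data.Nat.Properties
open import Algebra.Properties.CommutativeSemigroup +-commutativeSemigroup using (interchange)
open import Data.Product using (_×_; _,_; Σ; proj₁; proj₂)
open import Data.Product.Properties using (≡-dec)
open import Data.Sum using (_⊎_; inj₁; inj₂)
open import Data.Vec using (Vec; []; _∷_; lookup; tabulate)
open import Data.Vec.Properties using (lookup∘tabulate)
open import Function using (_∘_)
open import Function.Bundles using (Equivalence)
open import Relation.Binary.Definitions using (DecidableEquality; tri<; tri≈; tri>)
open import Relation.Binary.PropositionalEquality
open import Relation.Nullary using (¬_; yes; no; Dec)
open import Relation.Nullary.Decidable using (True; toWitness)


module _ {A : Set} where

  Unique⇒lookup-injective : ∀ {xs : List A} → Unique xs → ∀ {i j} → List.lookup xs i ≡ List.lookup xs j → i ≡ j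
  Unique⇒lookup-injective (_ ∷ _)  {Fin.zero}  {Fin.zero}  _ = refl
  Unique⇒lookup-injective (x∉ ∷ _) {Fin.zero}  {Fin.suc j} e = ⊥-elim (All.lookup x∉ (∈-lookup j) e)
  Unique⇒lookup-injective (x∉ ∷ _) {Fin.suc i} {Fin.zero}  e = ⊥-elim (All.lookup x∉ (∈-lookup i) (sym e))
  Unique⇒lookup-injective (_ ∷ u)  {Fin.suc i} {Fin.suc j} e = cong Fin.suc (Unique⇒lookup-injective u e)

  Unique-injection⇒length≤ : ∀ {k} {xs : List A} (f : A → Fin k) → Unique xs →
                             (∀ {x y} → x ∈ xs → y ∈ xs → f x ≡ f y → x ≡ y) → length xs ≤ k
  Unique-injection⇒length≤ f u inj =
    injective⇒≤ (λ e → Unique⇒lookup-injective u (inj (∈-lookup _) (∈-lookup _) e))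

  Unique-⊆⇒length≤ : ∀ {xs ys : List A} → Unique xs → (∀ {x} → x ∈ xs → x ∈ ys) → length xs ≤ length ys
  Unique-⊆⇒length≤ {xs} {ys} u xs⊆ys = injective⇒≤ {f = position} λ {i} {j} e →
    Unique⇒lookup-injective u (begin
      List.lookup xs i                 ≡⟨ lookup-index (xs⊆ys (∈-lookup i)) ⟩
      List.lookup ys (position i)      ≡⟨ cong (List.lookup ys) e ⟩
      List.lookup ys (position j)      ≡⟨ lookup-index (xs⊆ys (∈-lookup j)) ⟨
      List.lookup xs j                 ∎)
    where
    open ≡-Reasoning
    position : Fin (length xs) → Fin (length ys)
    position i = index (xs⊆ys (∈-lookup i))

2+n≢n : ∀ n → suc (suc n) ≢ n
2+n≢n (suc n) e = 2+n≢n n (suc-injective e)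

∣n-1+n∣≡1 : ∀ n → ∣ n - suc n ∣ ≡ 1
∣n-1+n∣≡1 zero    = refl
∣n-1+n∣≡1 (suc n) = ∣n-1+n∣≡1 n

∣1+n-n∣≡1 : ∀ n → ∣ suc n - n ∣ ≡ 1
∣1+n-n∣≡1 n = trans (∣-∣-comm (suc n) n) (∣n-1+n∣≡1 n)

∣m-n∣≡1⇒1+m≡n⊎m≡1+n : ∀ {a b} → ∣ a - b ∣ ≡ 1 → suc a ≡ b ⊎ a ≡ suc b
∣m-n∣≡1⇒1+m≡n⊎m≡1+n {zero}  {suc zero} _ = inj₁ refl
∣m-n∣≡1⇒1+m≡n⊎m≡1+n {suc zero} {zero} _ = inj₂ refl
∣m-n∣≡1⇒1+m≡n⊎m≡1+n {suc a} {suc b} e with ∣m-n∣≡1⇒1+m≡n⊎m≡1+n {a} {b} e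
... | inj₁ q = inj₁ (cong suc q)
... | inj₂ q = inj₂ (cong suc q)

∣1+m-n∣<∣m-n∣⇒m<n : ∀ a c → suc ∣ suc a - c ∣ ≡ ∣ a - c ∣ → a < c
∣1+m-n∣<∣m-n∣⇒m<n zero    (suc c) _ = s≤s z≤n
∣1+m-n∣<∣m-n∣⇒m<n (suc a) zero    e = ⊥-elim (2+n≢n a (suc-injective e))
∣1+m-n∣<∣m-n∣⇒m<n (suc a) (suc c) e = s≤s (∣1+m-n∣<∣m-n∣⇒m<n a c e)

∣m-n∣<∣1+m-n∣⇒n<1+m : ∀ a c → suc ∣ a - c ∣ ≡ ∣ suc a - c ∣ → c < suc a
∣m-n∣<∣1+m-n∣⇒n<1+m zero    zero    _ = s≤s z≤n
∣m-n∣<∣1+m-n∣⇒n<1+m zero    (suc c) e = ⊥-elim (2+n≢n c e)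
∣m-n∣<∣1+m-n∣⇒n<1+m (suc a) zero    _ = s≤s z≤n
∣m-n∣<∣1+m-n∣⇒n<1+m (suc a) (suc c) e = s≤s (∣m-n∣<∣1+m-n∣⇒n<1+m a c e)

1+m+o≡n+o⇒1+m≡n : ∀ {a b} c → suc (a + c) ≡ b + c → suc a ≡ b
1+m+o≡n+o⇒1+m≡n {a} {b} c e = +-cancelʳ-≡ c (suc a) b e

1+o+m≡o+n⇒1+m≡n : ∀ {a b} c → suc (c + a) ≡ c + b → suc a ≡ b
1+o+m≡o+n⇒1+m≡n {a} {b} c e = +-cancelˡ-≡ c (suc a) b (trans (+-suc c a) e)

-- Grid geometry and walks

Cell : ℕ → ℕ → Set
Cell n m = Graph.Vertex (Grid n m)

module _ {n m : ℕ} where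

  ci cj : Cell n m → ℕ
  ci v = toℕ (proj₁ v)
  cj v = toℕ (proj₂ v)

  cell-ext : ∀ {u v : Cell n m} → ci u ≡ ci v → cj u ≡ cj v → u ≡ v
  cell-ext p q = cong₂ _,_ (toℕ-injective p) (toℕ-injective q)

  dist : Cell n m → Cell n m → ℕ
  dist u v = ∣ ci u - ci v ∣ + ∣ cj u - cj v ∣

  dist-sym : ∀ u v → dist u v ≡ dist v u
  dist-sym u v = cong₂ _+_ (∣-∣-comm (ci u) (ci v)) (∣-∣-comm (cj u) (cj v))

  dist-self : ∀ u → dist u u ≡ 0
  dist-self u = cong₂ _+_ (∣n-n∣≡0 (ci u)) (∣n-n∣≡0 (cj u))

  dist-triangle : ∀ u v w → dist u w ≤ dist u v + dist v w
  dist-triangle u v w = ≤-trans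
    (+-mono-≤ (∣-∣-triangle (ci u) (ci v) (ci w)) (∣-∣-triangle (cj u) (cj v) (cj w)))
    (≤-reflexive (interchange ∣ ci u - ci v ∣ ∣ ci v - ci w ∣ ∣ cj u - cj v ∣ ∣ cj v - cj w ∣))

  data Step (u w : Cell n m) : Set where
    i+ : suc (ci u) ≡ ci w → cj u ≡ cj w → Step u w
    i- : ci u ≡ suc (ci w) → cj u ≡ cj w → Step u w
    j+ : ci u ≡ ci w → suc (cj u) ≡ cj w → Step u w
    j- : ci u ≡ ci w → cj u ≡ suc (cj w) → Step u w

  step : ∀ {u w} → dist u w ≡ 1 → Step u w
  step {u} {w} e with ∣ ci u - ci w ∣ in di
  ... | zero with ∣m-n∣≡1⇒1+m≡n⊎m≡1+n e
  ...   | inj₁ q = j+ (∣m-n∣≡0⇒m≡n di) q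
  ...   | inj₂ q = j- (∣m-n∣≡0⇒m≡n di) q
  step {u} {w} e | suc zero with ∣m-n∣≡1⇒1+m≡n⊎m≡1+n di
  ...   | inj₁ q = i+ q (∣m-n∣≡0⇒m≡n (suc-injective e))
  ...   | inj₂ q = i- q (∣m-n∣≡0⇒m≡n (suc-injective e))

  data GeodesicStep (u v w : Cell n m) : Set where
    i+ : ci u < ci v → suc (ci u) ≡ ci w → cj u ≡ cj w → GeodesicStep u v w
    i- : ci v < ci u → ci u ≡ suc (ci w) → cj u ≡ cj w → GeodesicStep u v w
    j+ : cj u < cj v → ci u ≡ ci w → suc (cj u) ≡ cj w → GeodesicStep u v w
    j- : cj v < cj u → ci u ≡ ci w → cj u ≡ suc (cj w) → GeodesicStep u v w

  geodesicStep : ∀ {u v w} → dist u w ≡ 1 → suc (dist w v) ≡ dist u v → GeodesicStep u v w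
  geodesicStep {u} {v} {w} e closer with step e
  ... | i+ p q = i+ (∣1+m-n∣<∣m-n∣⇒m<n (ci u) (ci v) (1+m+o≡n+o⇒1+m≡n _ closer′)) p q
    where
    closer′ : suc (∣ suc (ci u) - ci v ∣ + ∣ cj u - cj v ∣) ≡ dist u v
    closer′ = subst₂ (λ a b → suc (∣ a - ci v ∣ + ∣ b - cj v ∣) ≡ dist u v) (sym p) (sym q) closer
  ... | i- p q = i- (subst (ci v <_) (sym p) (∣m-n∣<∣1+m-n∣⇒n<1+m (ci w) (ci v) (1+m+o≡n+o⇒1+m≡n _ closer′))) p q
    where
    closer′ : suc (dist w v) ≡ ∣ suc (ci w) - ci v ∣ + ∣ cj w - cj v ∣
    closer′ = subst₂ (λ a b → suc (dist w v) ≡ ∣ a - ci v ∣ + ∣ b - cj v ∣) p q closer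
  ... | j+ p q = j+ (∣1+m-n∣<∣m-n∣⇒m<n (cj u) (cj v) (1+o+m≡o+n⇒1+m≡n _ closer′)) p q
    where
    closer′ : suc (∣ ci u - ci v ∣ + ∣ suc (cj u) - cj v ∣) ≡ dist u v
    closer′ = subst₂ (λ a b → suc (∣ a - ci v ∣ + ∣ b - cj v ∣) ≡ dist u v) (sym p) (sym q) closer
  ... | j- p q = j- (subst (cj v <_) (sym q) (∣m-n∣<∣1+m-n∣⇒n<1+m (cj w) (cj v) (1+o+m≡o+n⇒1+m≡n _ closer′))) p q
    where
    closer′ : suc (dist w v) ≡ ∣ ci w - ci v ∣ + ∣ suc (cj w) - cj v ∣
    closer′ = subst₂ (λ a b → suc (dist w v) ≡ ∣ a - ci v ∣ + ∣ b - cj v ∣) p q closer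

module _ {n m : ℕ} where

  len : ∀ {u v : Cell n m} → Walk (Grid n m) u v → ℕ
  len = walkLength (Grid n m)

  vertices : ∀ {u v : Cell n m} → Walk (Grid n m) u v → List (Cell n m)
  vertices = walkVertices (Grid n m)

  dist≤len : ∀ {u v} (p : Walk (Grid n m) u v) → dist u v ≤ len p
  dist≤len {u} []                      = ≤-reflexive (dist-self u)
  dist≤len {u} {v} (_∷_ {w = w} e p) = ≤-trans (dist-triangle u w v)
    (subst (λ d → d + dist w v ≤ suc (len p)) (sym e) (s≤s (dist≤len p)))

  head∈vertices : ∀ {u v} (p : Walk (Grid n m) u v) → u ∈ vertices p
  head∈vertices []      = here refl
  head∈vertices (_ ∷ _) = here refl

  snoc : ∀ {u v w} → Walk (Grid n m) u v → dist v w ≡ 1 → Walk (Grid n m) u w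
  snoc []      e = e ∷ []
  snoc (x ∷ p) e = x ∷ snoc p e

  len-snoc : ∀ {u v w} (p : Walk (Grid n m) u v) (e : dist v w ≡ 1) → len (snoc p e) ≡ suc (len p)
  len-snoc []      e = refl
  len-snoc (x ∷ p) e = cong suc (len-snoc p e)

  vertices-snoc : ∀ {u v w} (p : Walk (Grid n m) u v) (e : dist v w ≡ 1) →
                  vertices (snoc p e) ≡ vertices p ++ w ∷ []
  vertices-snoc []          e = refl
  vertices-snoc {u} (x ∷ p) e = cong (u ∷_) (vertices-snoc p e)

  reverse : ∀ {u v} → Walk (Grid n m) u v → Walk (Grid n m) v u
  reverse []                      = []
  reverse {u} (_∷_ {w = w} e p) = snoc (reverse p) (trans (dist-sym w u) e)

  len-reverse : ∀ {u v} (p : Walk (Grid n m) u v) → len (reverse p) ≡ len p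
  len-reverse []                      = refl
  len-reverse {u} (_∷_ {w = w} e p) =
    trans (len-snoc (reverse p) (trans (dist-sym w u) e)) (cong suc (len-reverse p))

  ∈-reverse⁻ : ∀ {u v x} (p : Walk (Grid n m) u v) → x ∈ vertices (reverse p) → x ∈ vertices p
  ∈-reverse⁻ []                      x∈ = x∈
  ∈-reverse⁻ {u} {x = x} (_∷_ {w = w} e p) x∈
    with ∈-++⁻ (vertices (reverse p)) (subst (x ∈_) (vertices-snoc (reverse p) (trans (dist-sym w u) e)) x∈)
  ... | inj₁ x∈p         = there (∈-reverse⁻ p x∈p)
  ... | inj₂ (here refl) = here refl

-- Clear geodesics towards the north-east

toℕ-pred : ∀ {k} (i : Fin k) → toℕ (Fin.pred i) ≡ pred (toℕ i)
toℕ-pred Fin.zero    = refl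
toℕ-pred (Fin.suc i) = toℕ-inject₁ i

suc-pred-< : ∀ {a c} → a < c → suc (pred c) ≡ c
suc-pred-< (s≤s _) = refl

1+[pred[n]∸m]≡n∸m : ∀ {a c} → a < c → suc (pred c ∸ a) ≡ c ∸ a
1+[pred[n]∸m]≡n∸m (s≤s a≤c) = sym (+-∸-assoc 1 a≤c)

module _ {n m : ℕ} where

  _≟ᶜ_ : DecidableEquality (Cell n m)
  _≟ᶜ_ = ≡-dec Fin._≟_ Fin._≟_

  open import Data.List.Membership.DecPropositional _≟ᶜ_ using (_∈?_) public

  adjacentI : ∀ {u v : Cell n m} → suc (ci u) ≡ ci v → cj u ≡ cj v → dist u v ≡ 1
  adjacentI {u} {v} p q = subst₂ (λ a b → ∣ ci u - a ∣ + ∣ cj u - b ∣ ≡ 1) p q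
    (cong₂ _+_ (∣n-1+n∣≡1 (ci u)) (∣n-n∣≡0 (cj u)))

  adjacentJ : ∀ {u v : Cell n m} → ci u ≡ ci v → suc (cj u) ≡ cj v → dist u v ≡ 1
  adjacentJ {u} {v} p q = subst₂ (λ a b → ∣ ci u - a ∣ + ∣ cj u - b ∣ ≡ 1) p q
    (cong₂ _+_ (∣n-n∣≡0 (ci u)) (∣n-1+n∣≡1 (cj u)))

  left below : Cell n m → Cell n m
  left  (i , j) = Fin.pred i , j
  below (i , j) = i , Fin.pred j

  ci-left : ∀ v → ci (left v) ≡ pred (ci v)
  ci-left v = toℕ-pred (proj₁ v)

  cj-below : ∀ v → cj (below v) ≡ pred (cj v)
  cj-below v = toℕ-pred (proj₂ v)

  ci-left-suc : ∀ {a} v → a < ci v → suc (ci (left v)) ≡ ci v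
  ci-left-suc v lt = trans (cong suc (ci-left v)) (suc-pred-< lt)

  cj-below-suc : ∀ {a} v → a < cj v → suc (cj (below v)) ≡ cj v
  cj-below-suc v lt = trans (cong suc (cj-below v)) (suc-pred-< lt)

  Clear : List (Cell n m) → ∀ {u v} → Walk (Grid n m) u v → Set
  Clear X {u} {v} p = ∀ x → x ∈ vertices p → x ∈ X → x ≡ u ⊎ x ≡ v

  ClearGeodesic : List (Cell n m) → Cell n m → Cell n m → Set
  ClearGeodesic X u v = Σ (Walk (Grid n m) u v) λ p → len p ≡ dist u v × Clear X p

  Clear-snoc : ∀ {X u w v} (p : Walk (Grid n m) u w) → Clear X p → (w ∈ X → w ≡ u) →
               (e : dist w v ≡ 1) → Clear X (snoc p e)
  Clear-snoc {X} {w = w} p clear w-ok e x x∈ x∈X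
    with ∈-++⁻ (vertices p) (subst (x ∈_) (vertices-snoc p e) x∈)
  ... | inj₂ (here refl) = inj₂ refl
  ... | inj₁ x∈p with clear x x∈p x∈X
  ...   | inj₁ x≡u    = inj₁ x≡u
  ...   | inj₂ refl   = inj₁ (w-ok x∈X)

  -- Built backwards from the target: the last step comes from below if that cell is not in X,
  -- and otherwise from the left; the three hypotheses are exactly what makes one of them free.
  module NorthEast (X : List (Cell n m)) (u : Cell n m)
    (row : ∀ x → x ∈ X → cj x ≡ cj u → ci u < ci x → suc (ci x) ≡ n)
    (column : ∀ x → x ∈ X → ci x ≡ ci u → cj u < cj x → suc (cj x) ≡ m)
    (antidiagonal : ∀ x y → x ∈ X → y ∈ X → suc (ci y) ≡ ci x → suc (cj x) ≡ cj y → ⊥) where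

    ClearWalk : ℕ → Cell n m → Set
    ClearWalk k v = Σ (Walk (Grid n m) u v) λ p → len p ≡ k × Clear X p

    extend : ∀ {k w v} → ClearWalk k w → (w ∈ X → w ≡ u) → dist w v ≡ 1 → ClearWalk (suc k) v
    extend (p , l , clear) w-ok e = snoc p e , trans (len-snoc p e) (cong suc l) , Clear-snoc p clear w-ok e

    gap : Cell n m → ℕ
    gap v = (ci v ∸ ci u) + (cj v ∸ cj u)

    gap-left : ∀ {v k} → ci u < ci v → gap v ≡ suc k → gap (left v) ≡ k
    gap-left {v} {k} lt e = suc-injective (begin
      suc ((ci (left v) ∸ ci u) + (cj v ∸ cj u)) ≡⟨ cong (λ a → suc ((a ∸ ci u) + (cj v ∸ cj u))) (ci-left v) ⟩
      suc ((pred (ci v) ∸ ci u) + (cj v ∸ cj u)) ≡⟨ cong (_+ (cj v ∸ cj u)) (1+[pred[n]∸m]≡n∸m lt) ⟩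
      gap v                                       ≡⟨ e ⟩
      suc k                                       ∎)
      where open ≡-Reasoning

    gap-below : ∀ {v k} → cj u < cj v → gap v ≡ suc k → gap (below v) ≡ k
    gap-below {v} {k} lt e = suc-injective (begin
      suc ((ci v ∸ ci u) + (cj (below v) ∸ cj u)) ≡⟨ cong (λ b → suc ((ci v ∸ ci u) + (b ∸ cj u))) (cj-below v) ⟩
      suc ((ci v ∸ ci u) + (pred (cj v) ∸ cj u)) ≡⟨ sym (+-suc _ _) ⟩
      (ci v ∸ ci u) + suc (pred (cj v) ∸ cj u)   ≡⟨ cong ((ci v ∸ ci u) +_) (1+[pred[n]∸m]≡n∸m lt) ⟩
      gap v                                       ≡⟨ e ⟩
      suc k                                       ∎)
      where open ≡-Reasoning

    gap-self : gap u ≡ 0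
    gap-self = cong₂ _+_ (n∸n≡0 (ci u)) (n∸n≡0 (cj u))

    gap≡0⇒≡u : ∀ {v} → ci u ≤ ci v → cj u ≤ cj v → gap v ≡ 0 → v ≡ u
    gap≡0⇒≡u {v} i≤ j≤ e = cell-ext
      (≤-antisym (m∸n≡0⇒m≤n (m+n≡0⇒m≡0 _ e)) i≤)
      (≤-antisym (m∸n≡0⇒m≤n (m+n≡0⇒n≡0 (ci v ∸ ci u) e)) j≤)

    gap≡suc⇒≢u : ∀ {v k} → gap v ≡ suc k → v ≢ u
    gap≡suc⇒≢u e refl = 0≢1+n (trans (sym gap-self) e)

    left-in-row : ∀ {v} → cj v ≡ cj u → ci u < ci v → left v ∈ X → left v ≡ u
    left-in-row {v} same lt l∈X with m≤n⇒m<n∨m≡n (s≤s⁻¹ (subst (ci u <_) (sym (ci-left-suc v lt)) lt))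
    ... | inj₂ eq  = cell-ext (sym eq) same
    ... | inj₁ lt′ = ⊥-elim (<-irrefl (row (left v) l∈X same lt′)
                                      (subst (_< n) (sym (ci-left-suc v lt)) (toℕ<n (proj₁ v))))

    below-in-column : ∀ {v} → ci v ≡ ci u → cj u < cj v → below v ∈ X → below v ≡ u
    below-in-column {v} same lt b∈X with m≤n⇒m<n∨m≡n (s≤s⁻¹ (subst (cj u <_) (sym (cj-below-suc v lt)) lt))
    ... | inj₂ eq  = cell-ext same (sym eq)
    ... | inj₁ lt′ = ⊥-elim (<-irrefl (column (below v) b∈X same lt′)
                                      (subst (_< m) (sym (cj-below-suc v lt)) (toℕ<n (proj₂ v))))

    toward : ∀ k v → ci u ≤ ci v → cj u ≤ cj v → gap v ≡ k → ClearWalk k v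
    via-left : ∀ k v → cj u ≤ cj v → gap v ≡ suc k → ci u < ci v →
               (left v ∈ X → left v ≡ u) → ClearWalk (suc k) v
    via-below : ∀ k v → ci u ≤ ci v → gap v ≡ suc k → cj u < cj v →
                (below v ∈ X → below v ≡ u) → ClearWalk (suc k) v

    toward zero v i≤ j≤ e =
      subst (ClearWalk 0) (sym (gap≡0⇒≡u i≤ j≤ e)) ([] , refl , λ { x (here refl) _ → inj₁ refl })
    toward (suc k) v i≤ j≤ e with m≤n⇒m<n∨m≡n j≤
    ... | inj₂ j≡ = via-left k v j≤ e i< (left-in-row (sym j≡) i<)
      where
      i< : ci u < ci v
      i< with m≤n⇒m<n∨m≡n i≤
      ... | inj₁ lt = lt
      ... | inj₂ i≡ = ⊥-elim (gap≡suc⇒≢u e (sym (cell-ext i≡ j≡)))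
    ... | inj₁ j< with below v ∈? X | below v ≟ᶜ u
    ...   | no b∉X  | _       = via-below k v i≤ e j< (λ b∈X → ⊥-elim (b∉X b∈X))
    ...   | yes _   | yes b≡u = via-below k v i≤ e j< (λ _ → b≡u)
    ...   | yes b∈X | no b≢u  = via-left k v (<⇒≤ j<) e i<
        (λ l∈X → ⊥-elim (antidiagonal (below v) (left v) b∈X l∈X (ci-left-suc v i<) (cj-below-suc v j<)))
      where
      i< : ci u < ci v
      i< with m≤n⇒m<n∨m≡n i≤
      ... | inj₁ lt = lt
      ... | inj₂ i≡ = ⊥-elim (b≢u (below-in-column (sym i≡) j< b∈X))

    via-left k v j≤ e lt ok = extend
      (toward k (left v) (s≤s⁻¹ (subst (ci u <_) (sym (ci-left-suc v lt)) lt)) j≤ (gap-left lt e))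
      ok (adjacentI {left v} {v} (ci-left-suc v lt) refl)

    via-below k v i≤ e lt ok = extend
      (toward k (below v) i≤ (s≤s⁻¹ (subst (cj u <_) (sym (cj-below-suc v lt)) lt)) (gap-below lt e))
      ok (adjacentJ {below v} {v} refl (cj-below-suc v lt))

    clear-north-east : ∀ v → ci u ≤ ci v → cj u ≤ cj v → ClearGeodesic X u v
    clear-north-east v i≤ j≤ with toward _ v i≤ j≤ refl
    ... | p , l , clear = p , trans l (sym (cong₂ _+_ (m≤n⇒∣m-n∣≡n∸m i≤) (m≤n⇒∣m-n∣≡n∸m j≤))) , clear

-- Symmetries of the grid

ClearGeodesic-antimono : ∀ {n m} {X Y : List (Cell n m)} {u v} → (∀ {x} → x ∈ Y → x ∈ X) →
                  ClearGeodesic X u v → ClearGeodesic Y u v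
ClearGeodesic-antimono Y⊆X (p , l , clear) = p , l , λ x x∈p x∈Y → clear x x∈p (Y⊆X x∈Y)

record Isometry (n m n′ m′ : ℕ) : Set where
  field
    to      : Cell n m → Cell n′ m′
    from    : Cell n′ m′ → Cell n m
    from-to : ∀ u → from (to u) ≡ u
    to-from : ∀ v → to (from v) ≡ v
    dist-to : ∀ u v → dist (to u) (to v) ≡ dist u v

  to-injective : ∀ {u v} → to u ≡ to v → u ≡ v
  to-injective {u} {v} e = trans (sym (from-to u)) (trans (cong from e) (from-to v))

  walk : ∀ {u v} → Walk (Grid n m) u v → Walk (Grid n′ m′) (to u) (to v)
  walk []                      = []
  walk {u} (_∷_ {w = w} e p) = trans (dist-to u w) e ∷ walk p

  len-walk : ∀ {u v} (p : Walk (Grid n m) u v) → len (walk p) ≡ len p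
  len-walk []      = refl
  len-walk (_ ∷ p) = cong suc (len-walk p)

  vertices-walk : ∀ {u v} (p : Walk (Grid n m) u v) → vertices (walk p) ≡ map to (vertices p)
  vertices-walk []          = refl
  vertices-walk {u} (_ ∷ p) = cong (to u ∷_) (vertices-walk p)

  ClearGeodesic-to : ∀ {X u v} → ClearGeodesic X u v → ClearGeodesic (map to X) (to u) (to v)
  ClearGeodesic-to {X} {u} {v} (p , l , clear) =
    walk p , trans (len-walk p) (trans l (sym (dist-to u v))) , clear′
    where
    clear′ : Clear (map to X) (walk p)
    clear′ y y∈ y∈X with ∈-map⁻ to (subst (y ∈_) (vertices-walk p) y∈) | ∈-map⁻ to y∈X
    ... | x , x∈p , refl | x′ , x′∈X , tx≡tx′ with clear x x∈p (subst (_∈ X) (sym (to-injective tx≡tx′)) x′∈X)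
    ...   | inj₁ refl = inj₁ refl
    ...   | inj₂ refl = inj₂ refl

module _ {n m n′ m′ : ℕ} (σ : Isometry n m n′ m′) where
  open Isometry σ

  inverse : Isometry n′ m′ n m
  inverse = record
    { to = from ; from = to ; from-to = to-from ; to-from = from-to
    ; dist-to = λ u v → trans (sym (dist-to (from u) (from v))) (cong₂ dist (to-from u) (to-from v)) }

  ClearGeodesic-from : ∀ {X u v} → ClearGeodesic (map to X) (to u) (to v) → ClearGeodesic X u v
  ClearGeodesic-from {X} {u} {v} g =
    subst₂ (ClearGeodesic X) (from-to u) (from-to v)
      (ClearGeodesic-antimono (λ {x} x∈X → subst (_∈ map from (map to X)) (from-to x) (∈-map⁺ from (∈-map⁺ to x∈X)))
                       (Isometry.ClearGeodesic-to inverse g))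

∣[o∸m]-[o∸n]∣≡∣m-n∣ : ∀ o a b → a ≤ o → b ≤ o → ∣ (o ∸ a) - (o ∸ b) ∣ ≡ ∣ a - b ∣
∣[o∸m]-[o∸n]∣≡∣m-n∣ o       zero    zero    _ _ = ∣n-n∣≡0 o
∣[o∸m]-[o∸n]∣≡∣m-n∣ o       zero    (suc b) _ b≤o =
  trans (m≤n⇒∣n-m∣≡n∸m (m∸n≤m o (suc b))) (m∸[m∸n]≡n b≤o)
∣[o∸m]-[o∸n]∣≡∣m-n∣ o       (suc a) zero    a≤o _ =
  trans (m≤n⇒∣m-n∣≡n∸m (m∸n≤m o (suc a))) (m∸[m∸n]≡n a≤o)
∣[o∸m]-[o∸n]∣≡∣m-n∣ (suc o) (suc a) (suc b) (s≤s a≤o) (s≤s b≤o) =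
  ∣[o∸m]-[o∸n]∣≡∣m-n∣ o a b a≤o b≤o

module _ {k : ℕ} where

  ∣-∣-opposite : ∀ (i j : Fin k) → ∣ toℕ (Fin.opposite i) - toℕ (Fin.opposite j) ∣ ≡ ∣ toℕ i - toℕ j ∣
  ∣-∣-opposite i j = trans (cong₂ ∣_-_∣ (opposite-prop i) (opposite-prop j))
                           (∣[o∸m]-[o∸n]∣≡∣m-n∣ k (suc (toℕ i)) (suc (toℕ j)) (toℕ<n i) (toℕ<n j))

  opposite-injective : ∀ {i j : Fin k} → Fin.opposite i ≡ Fin.opposite j → i ≡ j
  opposite-injective {i} {j} e = trans (sym (opposite-involutive i)) (trans (cong Fin.opposite e) (opposite-involutive j))

  opposite-mono-≥ : ∀ {i j : Fin k} → toℕ j ≤ toℕ i → toℕ (Fin.opposite i) ≤ toℕ (Fin.opposite j)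
  opposite-mono-≥ {i} {j} j≤i = subst₂ _≤_ (sym (opposite-prop i)) (sym (opposite-prop j)) (∸-monoʳ-≤ k (s≤s j≤i))

  opposite-mono-> : ∀ {i j : Fin k} → toℕ j < toℕ i → toℕ (Fin.opposite i) < toℕ (Fin.opposite j)
  opposite-mono-> {i} {j} j<i = subst₂ _<_ (sym (opposite-prop i)) (sym (opposite-prop j)) (∸-monoʳ-< (s≤s j<i) (toℕ<n i))

module _ {n m : ℕ} where

  reflectI : Isometry n m n m
  reflectI = record
    { to      = λ { (i , j) → Fin.opposite i , j }
    ; from    = λ { (i , j) → Fin.opposite i , j }
    ; from-to = λ { (i , j) → cong (_, j) (opposite-involutive i) }
    ; to-from = λ { (i , j) → cong (_, j) (opposite-involutive i) }
    ; dist-to = λ { (i , j) (k , l) → cong (_+ ∣ toℕ j - toℕ l ∣) (∣-∣-opposite i k) } }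

  reflectJ : Isometry n m n m
  reflectJ = record
    { to      = λ { (i , j) → i , Fin.opposite j }
    ; from    = λ { (i , j) → i , Fin.opposite j }
    ; from-to = λ { (i , j) → cong (i ,_) (opposite-involutive j) }
    ; to-from = λ { (i , j) → cong (i ,_) (opposite-involutive j) }
    ; dist-to = λ { (i , j) (k , l) → cong (∣ toℕ i - toℕ k ∣ +_) (∣-∣-opposite j l) } }

  transpose : Isometry n m m n
  transpose = record
    { to      = λ { (i , j) → j , i }
    ; from    = λ { (j , i) → i , j }
    ; from-to = λ _ → refl
    ; to-from = λ _ → refl
    ; dist-to = λ { (i , j) (k , l) → +-comm ∣ toℕ j - toℕ l ∣ ∣ toℕ i - toℕ k ∣ } }

-- Admissible sets

IsEnd : ℕ → ℕ → Set
IsEnd N a = a ≡ 0 ⊎ suc a ≡ N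

IsEnd-opposite : ∀ {k} (i : Fin k) → IsEnd k (toℕ i) → IsEnd k (toℕ (Fin.opposite i))
IsEnd-opposite {k} i (inj₁ i≡0) = inj₂ (begin
  suc (toℕ (Fin.opposite i)) ≡⟨ cong suc (opposite-prop i) ⟩
  suc (k ∸ suc (toℕ i))      ≡⟨ cong (λ a → suc (k ∸ suc a)) i≡0 ⟩
  suc (k ∸ 1)                ≡⟨ m+[n∸m]≡n (subst (_< k) i≡0 (toℕ<n i)) ⟩
  k                          ∎)
  where open ≡-Reasoning
IsEnd-opposite {k} i (inj₂ 1+i≡k) = inj₁ (trans (opposite-prop i) (trans (cong (k ∸_) 1+i≡k) (n∸n≡0 k)))

IsEnd⇒last : ∀ {N a b} → IsEnd N a → b < a → suc a ≡ N
IsEnd⇒last (inj₁ refl) ()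
IsEnd⇒last (inj₂ e)    _ = e

module _ {n m : ℕ} where

  RowEnds : List (Cell n m) → Set
  RowEnds X = ∀ {x y} → x ∈ X → y ∈ X → cj x ≡ cj y → ci x ≢ ci y → IsEnd n (ci x)

  ColumnEnds : List (Cell n m) → Set
  ColumnEnds X = ∀ {x y} → x ∈ X → y ∈ X → ci x ≡ ci y → cj x ≢ cj y → IsEnd m (cj x)

  NoDiagonalPair : List (Cell n m) → Set
  NoDiagonalPair X = ∀ {x y} → x ∈ X → y ∈ X → ∣ ci x - ci y ∣ ≡ 1 → ∣ cj x - cj y ∣ ≡ 1 → ⊥

  record Admissible (X : List (Cell n m)) : Set where
    field
      rowEnds    : RowEnds X
      columnEnds : ColumnEnds X
      noDiagonal : NoDiagonalPair X

  open Admissible public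

  clear-north-east : ∀ {X u v} → Admissible X → u ∈ X → ci u ≤ ci v → cj u ≤ cj v → ClearGeodesic X u v
  clear-north-east {X} {u} {v} A u∈X = NorthEast.clear-north-east X u row column antidiagonal v
    where
    row : ∀ x → x ∈ X → cj x ≡ cj u → ci u < ci x → suc (ci x) ≡ n
    row x x∈X same lt = IsEnd⇒last (rowEnds A x∈X u∈X same (λ e → <-irrefl (sym e) lt)) lt
    column : ∀ x → x ∈ X → ci x ≡ ci u → cj u < cj x → suc (cj x) ≡ m
    column x x∈X same lt = IsEnd⇒last (columnEnds A x∈X u∈X same (λ e → <-irrefl (sym e) lt)) lt
    antidiagonal : ∀ x y → x ∈ X → y ∈ X → suc (ci y) ≡ ci x → suc (cj x) ≡ cj y → ⊥
    antidiagonal x y x∈X y∈X ei ej = noDiagonal A x∈X y∈X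
      (subst (λ a → ∣ a - ci y ∣ ≡ 1) ei (∣1+n-n∣≡1 (ci y)))
      (subst (λ b → ∣ cj x - b ∣ ≡ 1) ej (∣n-1+n∣≡1 (cj x)))

  Admissible-reflectI : ∀ {X} → Admissible X → Admissible (map (Isometry.to reflectI) X)
  Admissible-reflectI {X} A = record { rowEnds = rows ; columnEnds = columns ; noDiagonal = diagonals }
    where
    ρ : Cell n m → Cell n m
    ρ = Isometry.to reflectI
    rows : RowEnds (map ρ X)
    rows x∈ y∈ same ne with ∈-map⁻ ρ x∈ | ∈-map⁻ ρ y∈
    ... | x , x∈X , refl | y , y∈X , refl =
      IsEnd-opposite (proj₁ x) (rowEnds A x∈X y∈X same (λ e → ne (cong (toℕ ∘ Fin.opposite) (toℕ-injective e))))
    columns : ColumnEnds (map ρ X)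
    columns x∈ y∈ same ne with ∈-map⁻ ρ x∈ | ∈-map⁻ ρ y∈
    ... | x , x∈X , refl | y , y∈X , refl = columnEnds A x∈X y∈X (cong toℕ (opposite-injective (toℕ-injective same))) ne
    diagonals : NoDiagonalPair (map ρ X)
    diagonals x∈ y∈ di dj with ∈-map⁻ ρ x∈ | ∈-map⁻ ρ y∈
    ... | x , x∈X , refl | y , y∈X , refl =
      noDiagonal A x∈X y∈X (trans (sym (∣-∣-opposite (proj₁ x) (proj₁ y))) di) dj

  Admissible-reflectJ : ∀ {X} → Admissible X → Admissible (map (Isometry.to reflectJ) X)
  Admissible-reflectJ {X} A = record { rowEnds = rows ; columnEnds = columns ; noDiagonal = diagonals }
    where
    ρ : Cell n m → Cell n m
    ρ = Isometry.to reflectJ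
    rows : RowEnds (map ρ X)
    rows x∈ y∈ same ne with ∈-map⁻ ρ x∈ | ∈-map⁻ ρ y∈
    ... | x , x∈X , refl | y , y∈X , refl = rowEnds A x∈X y∈X (cong toℕ (opposite-injective (toℕ-injective same))) ne
    columns : ColumnEnds (map ρ X)
    columns x∈ y∈ same ne with ∈-map⁻ ρ x∈ | ∈-map⁻ ρ y∈
    ... | x , x∈X , refl | y , y∈X , refl =
      IsEnd-opposite (proj₂ x) (columnEnds A x∈X y∈X same (λ e → ne (cong (toℕ ∘ Fin.opposite) (toℕ-injective e))))
    diagonals : NoDiagonalPair (map ρ X)
    diagonals x∈ y∈ di dj with ∈-map⁻ ρ x∈ | ∈-map⁻ ρ y∈
    ... | x , x∈X , refl | y , y∈X , refl =
      noDiagonal A x∈X y∈X di (trans (sym (∣-∣-opposite (proj₂ x) (proj₂ y))) dj)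

  clear-north : ∀ {X u v} → Admissible X → u ∈ X → cj u ≤ cj v → ClearGeodesic X u v
  clear-north {X} {u} {v} A u∈X j≤ with ci u ≤? ci v
  ... | yes i≤ = clear-north-east A u∈X i≤ j≤
  ... | no i≰ = ClearGeodesic-from reflectI
      (clear-north-east (Admissible-reflectI A) (∈-map⁺ _ u∈X) (opposite-mono-≥ (<⇒≤ (≰⇒> i≰))) j≤)

  admissible⇒clear : ∀ {X u} → Admissible X → u ∈ X → ∀ v → ClearGeodesic X u v
  admissible⇒clear {X} {u} A u∈X v with cj u ≤? cj v
  ... | yes j≤ = clear-north A u∈X j≤
  ... | no j≰ = ClearGeodesic-from reflectJ
      (clear-north (Admissible-reflectJ A) (∈-map⁺ _ u∈X) (opposite-mono-≥ (<⇒≤ (≰⇒> j≰))))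

module _ {n m : ℕ} where

  singleton-admissible : (u : Cell n m) → Admissible (u ∷ [])
  singleton-admissible u = record
    { rowEnds    = λ { (here refl) (here refl) _ ne → ⊥-elim (ne refl) }
    ; columnEnds = λ { (here refl) (here refl) _ ne → ⊥-elim (ne refl) }
    ; noDiagonal = λ { (here refl) (here refl) d _ → 0≢1+n (trans (sym (∣n-n∣≡0 (ci u))) d) } }

  geodesic : ∀ (u v : Cell n m) → Σ (Walk (Grid n m) u v) λ p → len p ≡ dist u v
  geodesic u v with admissible⇒clear (singleton-admissible u) (here refl) v
  ... | p , l , _ = p , l

  shortest⇒len≡dist : ∀ {u v} (p : Walk (Grid n m) u v) → IsShortest (Grid n m) p → len p ≡ dist u v
  shortest⇒len≡dist {u} {v} p shortest = ≤-antisym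
    (≤-trans (shortest (proj₁ (geodesic u v))) (≤-reflexive (proj₂ (geodesic u v))))
    (dist≤len p)

  len≡dist⇒shortest : ∀ {u v} (p : Walk (Grid n m) u v) → len p ≡ dist u v → IsShortest (Grid n m) p
  len≡dist⇒shortest p l q = ≤-trans (≤-reflexive l) (dist≤len q)

  visible⇒clear : ∀ {X u v} → Visible (Grid n m) X u v → ClearGeodesic X u v
  visible⇒clear (p , shortest , clear) = p , shortest⇒len≡dist p shortest , clear

  clear⇒visible : ∀ {X u v} → ClearGeodesic X u v → Visible (Grid n m) X u v
  clear⇒visible (p , l , clear) = p , len≡dist⇒shortest p l , clear

  ClearGeodesic-reverse : ∀ {X : List (Cell n m)} {u v} → ClearGeodesic X u v → ClearGeodesic X v u
  ClearGeodesic-reverse {X} {u} {v} (p , l , clear) =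
    reverse p , trans (len-reverse p) (trans l (dist-sym u v)) , clear′
    where
    clear′ : Clear X (reverse p)
    clear′ x x∈ x∈X with clear x (∈-reverse⁻ p x∈) x∈X
    ... | inj₁ x≡u = inj₂ x≡u
    ... | inj₂ x≡v = inj₁ x≡v

  geodesic-tail : ∀ {u w v} (e : dist u w ≡ 1) (q : Walk (Grid n m) w v) → suc (len q) ≡ dist u v →
                  suc (dist w v) ≡ dist u v × len q ≡ dist w v
  geodesic-tail {u} {w} {v} e q l = closer , suc-injective (trans l (sym closer))
    where
    closer : suc (dist w v) ≡ dist u v
    closer = ≤-antisym (subst (suc (dist w v) ≤_) l (s≤s (dist≤len q)))
                       (subst (λ d → dist u v ≤ d + dist w v) e (dist-triangle u w v))

  AllClear : List (Cell n m) → Set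
  AllClear X = ∀ {u} → u ∈ X → ∀ v → ClearGeodesic X u v

  outerMV⇒allClear : ∀ {X} → IsOuterMV (Grid n m) X → AllClear X
  outerMV⇒allClear {X} (_ , inner , outer) {u} u∈X v with v ∈? X
  ... | yes v∈X = visible⇒clear (inner u v u∈X v∈X)
  ... | no v∉X  = visible⇒clear (outer u v u∈X v∉X)

  allClear⇒outerMV : ∀ {X} → Unique X → AllClear X → IsOuterMV (Grid n m) X
  allClear⇒outerMV U clear = U , (λ u v u∈X _ → clear⇒visible (clear u∈X v))
                               , (λ u v u∈X _ → clear⇒visible (clear u∈X v))

  admissible⇒outerMV : ∀ {X} → Unique X → Admissible X → IsOuterMV (Grid n m) X
  admissible⇒outerMV U A = allClear⇒outerMV U (admissible⇒clear A)

AllClear-isometry : ∀ {n m n′ m′} (σ : Isometry n m n′ m′) {X} → AllClear X → AllClear (map (Isometry.to σ) X)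
AllClear-isometry σ {X} clear u∈ v with ∈-map⁻ to u∈
  where open Isometry σ
... | u , u∈X , refl = subst (ClearGeodesic _ (to u)) (to-from v) (ClearGeodesic-to (clear u∈X (from v)))
  where open Isometry σ

-- Rows and columns of an outer mutual-visibility set

module _ {n m : ℕ} where

  clear-first-step : ∀ {X : List (Cell n m)} {u v} → ClearGeodesic X u v → u ≢ v →
    Σ (Cell n m) λ w → dist u w ≡ 1 × suc (dist w v) ≡ dist u v × (w ∈ X → w ≡ v)
  clear-first-step ([] , _ , _) u≢v = ⊥-elim (u≢v refl)
  clear-first-step {X} {u} {v} (_∷_ {w = w} e q , l , clear) _ =
    w , e , proj₁ (geodesic-tail {u = u} {w = w} {v = v} e q l) , w-ok
    where
    w-ok : w ∈ X → w ≡ v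
    w-ok w∈X with clear w (there (head∈vertices q)) w∈X
    ... | inj₁ refl = ⊥-elim (0≢1+n (trans (sym (dist-self u)) e))
    ... | inj₂ w≡v  = w≡v

  row-first-step : ∀ {z x y w : Cell n m} → suc (ci z) ≡ ci x → cj z ≡ cj x → cj x ≡ cj y → ci x < ci y →
                   GeodesicStep z y w → w ≡ x
  row-first-step zi zj _ _ (i+ _ p q) = sym (cell-ext (trans (sym zi) p) (trans (sym zj) q))
  row-first-step {z} zi _ _ lt (i- gt _ _) = ⊥-elim (<-asym (<-trans (subst (ci z <_) zi (n<1+n (ci z))) lt) gt)
  row-first-step _ zj same _ (j+ lt _ _) = ⊥-elim (<-irrefl (trans zj same) lt)
  row-first-step _ zj same _ (j- gt _ _) = ⊥-elim (<-irrefl (sym (trans zj same)) gt)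

  row-blocker : ∀ {X : List (Cell n m)} {z x y} → ClearGeodesic X z y → x ∈ X →
                suc (ci z) ≡ ci x → cj z ≡ cj x → cj x ≡ cj y → ci x < ci y → ⊥
  row-blocker {z = z} g x∈X zi zj same lt
    with clear-first-step g (λ z≡y → <-irrefl (cong ci z≡y) (<-trans (subst (ci z <_) zi (n<1+n (ci z))) lt))
  ... | w , e , closer , w-ok with row-first-step zi zj same lt (geodesicStep e closer)
  ...   | refl = <-irrefl (cong ci (w-ok x∈X)) lt

  allClear⇒first-in-row : ∀ {X : List (Cell n m)} {x y} → AllClear X → x ∈ X → y ∈ X →
                          cj x ≡ cj y → ci x < ci y → ci x ≡ 0
  allClear⇒first-in-row {x = x} clear x∈X y∈X same lt with ci x ≟ 0
  ... | yes x≡0 = x≡0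
  ... | no x≢0  = ⊥-elim (row-blocker (ClearGeodesic-reverse (clear y∈X (left x))) x∈X
                                      (ci-left-suc x (n≢0⇒n>0 x≢0)) refl same lt)

allClear⇒rowEnds : ∀ {n m} {X : List (Cell n m)} → AllClear X → RowEnds X
allClear⇒rowEnds {n} {m} {X} clear {x} {y} x∈X y∈X same ne with <-cmp (ci x) (ci y)
... | tri< lt _ _ = inj₁ (allClear⇒first-in-row clear x∈X y∈X same lt)
... | tri≈ _ e _  = ⊥-elim (ne e)
... | tri> _ _ gt = subst (IsEnd n) (cong toℕ (opposite-involutive (proj₁ x)))
    (IsEnd-opposite (Fin.opposite (proj₁ x)) (inj₁ (allClear⇒first-in-row (AllClear-isometry reflectI clear)
      (∈-map⁺ ρ x∈X) (∈-map⁺ ρ y∈X) same (opposite-mono-> gt))))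
  where
  ρ : Cell n m → Cell n m
  ρ = Isometry.to reflectI

allClear⇒columnEnds : ∀ {n m} {X : List (Cell n m)} → AllClear X → ColumnEnds X
allClear⇒columnEnds {n} {m} clear x∈X y∈X same ne =
  allClear⇒rowEnds (AllClear-isometry transpose clear) (∈-map⁺ τ x∈X) (∈-map⁺ τ y∈X) same ne
  where
  τ : Cell n m → Cell m n
  τ = Isometry.to transpose

-- The upper bound m + 2

zero-of : ∀ {k} → Fin k → Fin k
zero-of Fin.zero    = Fin.zero
zero-of (Fin.suc _) = Fin.zero

toℕ-zero-of : ∀ {k} (i : Fin k) → toℕ (zero-of i) ≡ 0
toℕ-zero-of Fin.zero    = refl
toℕ-zero-of (Fin.suc _) = refl

module _ {n m : ℕ} where

  first : Cell n m → Cell n m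
  first (i , j) = zero-of i , j

  ci-first : ∀ v → ci (first v) ≡ 0
  ci-first v = toℕ-zero-of (proj₁ v)

  -- Two vertices of X share a row only as (first, last). The last one of such a pair is coded
  -- by m + 1 in the top row and by m elsewhere (ColumnEnds on the first ones forces the bottom
  -- row then); every other vertex is coded by its row.
  module Rows (X : List (Cell n m)) (rows : RowEnds X) (columns : ColumnEnds X) where

    data Kind (x : Cell n m) : Set where
      single : ¬ (suc (ci x) ≡ n × first x ∈ X) → Kind x
      paired : suc (ci x) ≡ n → first x ∈ X → Dec (suc (cj x) ≡ m) → Kind x

    kind : ∀ x → Kind x
    kind x with suc (ci x) ≟ n | first x ∈? X
    ... | yes last | yes f∈X = paired last f∈X (suc (cj x) ≟ m)
    ... | yes _    | no f∉X  = single (λ p → f∉X (proj₂ p))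
    ... | no ¬last | _       = single (λ p → ¬last (proj₁ p))

    code : ∀ {x} → Kind x → ℕ
    code {x} (single _)           = cj x
    code     (paired _ _ (no _))  = m
    code     (paired _ _ (yes _)) = suc m

    code< : ∀ {x} (k : Kind x) → code k < suc (suc m)
    code< {x} (single _)           = <-trans (toℕ<n (proj₂ x)) (<-trans (n<1+n m) (n<1+n (suc m)))
    code<     (paired _ _ (no _))  = <-trans (n<1+n m) (n<1+n (suc m))
    code<     (paired _ _ (yes _)) = n<1+n (suc m)

    single-injective : ∀ {x y} → x ∈ X → y ∈ X → ¬ (suc (ci x) ≡ n × first x ∈ X) →
                       ¬ (suc (ci y) ≡ n × first y ∈ X) → cj x ≡ cj y → x ≡ y
    single-injective {x} {y} x∈X y∈X ¬px ¬py same with ci x ≟ ci y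
    ... | yes e = cell-ext e same
    ... | no ne with rows x∈X y∈X same ne | rows y∈X x∈X (sym same) (ne ∘ sym)
    ...   | inj₁ x0 | inj₁ y0 = ⊥-elim (ne (trans x0 (sym y0)))
    ...   | inj₂ xl | inj₂ yl = ⊥-elim (ne (suc-injective (trans xl (sym yl))))
    ...   | inj₁ x0 | inj₂ yl = ⊥-elim (¬py (yl , subst (_∈ X) (cell-ext (trans x0 (sym (ci-first y))) same) x∈X))
    ...   | inj₂ xl | inj₁ y0 = ⊥-elim (¬px (xl , subst (_∈ X) (cell-ext (trans y0 (sym (ci-first x))) (sym same)) y∈X))

    bottom-injective : ∀ {x y} → suc (ci x) ≡ n → suc (ci y) ≡ n → first x ∈ X → first y ∈ X →
                       suc (cj x) ≢ m → suc (cj y) ≢ m → x ≡ y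
    bottom-injective {x} {y} xl yl fx fy ¬xt ¬yt with cj x ≟ cj y
    ... | yes e = cell-ext (suc-injective (trans xl (sym yl))) e
    ... | no ne with columns fx fy (trans (ci-first x) (sym (ci-first y))) ne
                   | columns fy fx (trans (ci-first y) (sym (ci-first x))) (ne ∘ sym)
    ...   | inj₂ xt | _       = ⊥-elim (¬xt xt)
    ...   | _       | inj₂ yt = ⊥-elim (¬yt yt)
    ...   | inj₁ x0 | inj₁ y0 = ⊥-elim (ne (trans x0 (sym y0)))

    code-injective : ∀ {x y} → x ∈ X → y ∈ X → (k : Kind x) (l : Kind y) → code k ≡ code l → x ≡ y
    code-injective x∈X y∈X (single ¬px) (single ¬py) e = single-injective x∈X y∈X ¬px ¬py e
    code-injective {x} _ _ (single _) (paired _ _ (no _))  e = ⊥-elim (<-irrefl e (toℕ<n (proj₂ x)))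
    code-injective {x} _ _ (single _) (paired _ _ (yes _)) e = ⊥-elim (<-irrefl e (m<n⇒m<1+n (toℕ<n (proj₂ x))))
    code-injective {y = y} _ _ (paired _ _ (no _))  (single _) e = ⊥-elim (<-irrefl (sym e) (toℕ<n (proj₂ y)))
    code-injective {y = y} _ _ (paired _ _ (yes _)) (single _) e = ⊥-elim (<-irrefl (sym e) (m<n⇒m<1+n (toℕ<n (proj₂ y))))
    code-injective _ _ (paired _ _ (no _))  (paired _ _ (yes _)) e = ⊥-elim (1+n≢n (sym e))
    code-injective _ _ (paired _ _ (yes _)) (paired _ _ (no _))  e = ⊥-elim (1+n≢n e)
    code-injective _ _ (paired xl fx (no ¬xt)) (paired yl fy (no ¬yt)) _ = bottom-injective xl yl fx fy ¬xt ¬yt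
    code-injective _ _ (paired xl _ (yes xt)) (paired yl _ (yes yt)) _ =
      cell-ext (suc-injective (trans xl (sym yl))) (suc-injective (trans xt (sym yt)))

    length≤ : Unique X → length X ≤ m + 2
    length≤ U = subst (length X ≤_) (+-comm 2 m)
      (Unique-injection⇒length≤ (λ x → fromℕ< (code< (kind x))) U λ {x} {y} x∈X y∈X e →
        code-injective x∈X y∈X (kind x) (kind y)
          (trans (sym (toℕ-fromℕ< (code< (kind x)))) (trans (cong toℕ e) (toℕ-fromℕ< (code< (kind y))))))

  outerMV-length≤ : ∀ {X} → IsOuterMV (Grid n m) X → length X ≤ m + 2
  outerMV-length≤ {X} O = Rows.length≤ X (allClear⇒rowEnds clear) (allClear⇒columnEnds clear) (proj₁ O)
    where
    clear : AllClear X
    clear = outerMV⇒allClear O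

-- Corners and placements

record Placement (n k : ℕ) : Set where
  field
    col           : ℕ → ℕ
    col-positive  : ∀ {j} → 1 ≤ j → j ≤ k → 1 ≤ col j
    col-inner     : ∀ {j} → 1 ≤ j → j ≤ k → 2 + col j ≤ n
    col-injective : ∀ {i j} → 1 ≤ i → i ≤ k → 1 ≤ j → j ≤ k → col i ≡ col j → i ≡ j
    col-spread    : ∀ {j} → 1 ≤ j → suc j ≤ k → ∣ col j - col (suc j) ∣ ≢ 1
    col-ends      : ∀ {j} → j ≡ 1 ⊎ j ≡ k → 1 ≤ j → j ≤ k → col j ≢ 1 × 2 + col j ≢ n

IsEnd-neighbour : ∀ {N a b} → IsEnd N a → 1 ≤ b → 2 + b ≤ N → ∣ a - b ∣ ≡ 1 → b ≡ 1 ⊎ 2 + b ≡ N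
IsEnd-neighbour (inj₁ refl) _ _ e = inj₁ e
IsEnd-neighbour {a = a} {b} (inj₂ refl) _ b+2≤N e with ∣m-n∣≡1⇒1+m≡n⊎m≡1+n {a} {b} e
... | inj₁ refl = ⊥-elim (1+n≰n (≤-trans (n≤1+n (suc a)) (s≤s⁻¹ b+2≤N)))
... | inj₂ refl = inj₂ refl

IsEnd-apart : ∀ {N a b} → 3 ≤ N → IsEnd N a → IsEnd N b → ∣ a - b ∣ ≢ 1
IsEnd-apart _ (inj₁ refl) (inj₁ refl) ()
IsEnd-apart {N} {a} {b} 3≤N (inj₁ refl) (inj₂ b+1≡N) e = <-irrefl (trans (cong suc (sym e)) b+1≡N) 3≤N
IsEnd-apart {N} {a} {b} 3≤N (inj₂ a+1≡N) (inj₁ refl) e =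
  <-irrefl (trans (cong suc (sym (trans (∣-∣-comm 0 a) e))) a+1≡N) 3≤N
IsEnd-apart {a = a} {b} _ (inj₂ a+1≡N) (inj₂ b+1≡N) e =
  0≢1+n (trans (sym (∣n-n∣≡0 a)) (subst (λ c → ∣ a - c ∣ ≡ 1) (sym (suc-injective (trans a+1≡N (sym b+1≡N)))) e))

module _ {n m : ℕ} where

  cell : ∀ a → a < n → ∀ b → b < m → Cell n m
  cell a a<n b b<m = fromℕ< a<n , fromℕ< b<m

  module CornersAndPlacement {k : ℕ} (3≤n : 3 ≤ n) (m≡2+k : m ≡ 2 + k) (P : Placement n k) where
    open Placement P

    0<n : 0 < n
    0<n = ≤-trans (s≤s z≤n) 3≤n

    0<m : 0 < m
    0<m = subst (0 <_) (sym m≡2+k) (s≤s z≤n)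

    n∸1<n : n ∸ 1 < n
    n∸1<n = subst (n ∸ 1 <_) (m+[n∸m]≡n 0<n) (n<1+n _)

    m∸1<m : m ∸ 1 < m
    m∸1<m = subst (m ∸ 1 <_) (m+[n∸m]≡n 0<m) (n<1+n _)

    corners : List (Cell n m)
    corners = cell 0 0<n 0 0<m ∷ cell 0 0<n (m ∸ 1) m∸1<m
            ∷ cell (n ∸ 1) n∸1<n 0 0<m ∷ cell (n ∸ 1) n∸1<n (m ∸ 1) m∸1<m ∷ []

    col<n : ∀ {j} → 1 ≤ j → j ≤ k → col j < n
    col<n 1≤j j≤k = ≤-trans (n≤1+n _) (col-inner 1≤j j≤k)

    j<m : ∀ {j} → j ≤ k → j < m
    j<m j≤k = subst (_ <_) (sym m≡2+k) (≤-trans (s≤s j≤k) (n≤1+n (suc k)))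

    points : ∀ j → j ≤ k → List (Cell n m)
    points zero    _   = []
    points (suc j) j≤k =
      cell (col (suc j)) (col<n (s≤s z≤n) j≤k) (suc j) (j<m j≤k) ∷ points j (≤-trans (n≤1+n j) j≤k)

    X : List (Cell n m)
    X = corners ++ points k ≤-refl

    data Point (x : Cell n m) (j′ : ℕ) : Set where
      point : ∀ {j} → 1 ≤ j → j ≤ j′ → ci x ≡ col j → cj x ≡ j → Point x j′

    ∈-points : ∀ {j j≤k x} → x ∈ points j j≤k → Point x j
    ∈-points {suc j} (here refl) = point (s≤s z≤n) ≤-refl (toℕ-fromℕ< _) (toℕ-fromℕ< _)
    ∈-points {suc j} (there x∈) with ∈-points x∈
    ... | point 1≤i i≤j ei ej = point 1≤i (≤-trans i≤j (n≤1+n j)) ei ej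

    data Member (x : Cell n m) : Set where
      corner : IsEnd n (ci x) → IsEnd m (cj x) → Member x
      inner  : ∀ {j} → 1 ≤ j → j ≤ k → ci x ≡ col j → cj x ≡ j → Member x

    last-end : ∀ {N} (p : N ∸ 1 < N) → 0 < N → suc (toℕ (fromℕ< p)) ≡ N
    last-end p 0<N = trans (cong suc (toℕ-fromℕ< p)) (m+[n∸m]≡n 0<N)

    member : ∀ {x} → x ∈ X → Member x
    member (here refl)                         = corner (inj₁ (toℕ-fromℕ< 0<n)) (inj₁ (toℕ-fromℕ< 0<m))
    member (there (here refl))                 = corner (inj₁ (toℕ-fromℕ< 0<n)) (inj₂ (last-end m∸1<m 0<m))
    member (there (there (here refl)))         = corner (inj₂ (last-end n∸1<n 0<n)) (inj₁ (toℕ-fromℕ< 0<m))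
    member (there (there (there (here refl)))) = corner (inj₂ (last-end n∸1<n 0<n)) (inj₂ (last-end m∸1<m 0<m))
    member (there (there (there (there x∈)))) with ∈-points x∈
    ... | point 1≤j j≤k ei ej = inner 1≤j j≤k ei ej

    inner-row : ∀ {j} → 1 ≤ j → j ≤ k → ¬ IsEnd m j
    inner-row () _ (inj₁ refl)
    inner-row _ j≤k (inj₂ e) = <-irrefl (suc-injective (trans e m≡2+k)) (s≤s j≤k)

    inner-column : ∀ {j} → 1 ≤ j → j ≤ k → ¬ IsEnd n (col j)
    inner-column 1≤j j≤k (inj₁ e) = <-irrefl (sym e) (col-positive 1≤j j≤k)
    inner-column 1≤j j≤k (inj₂ e) = <-irrefl e (col-inner 1≤j j≤k)

    rows : RowEnds X
    rows x∈ y∈ same ne with member x∈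
    ... | corner ex _ = ex
    ... | inner 1≤j j≤k ei ej with member y∈
    ...   | corner _ ey = ⊥-elim (inner-row 1≤j j≤k (subst (IsEnd m) (trans (sym same) ej) ey))
    ...   | inner _ _ fi fj = ⊥-elim (ne (trans ei (trans (cong col (trans (sym ej) (trans same fj))) (sym fi))))

    columns : ColumnEnds X
    columns x∈ y∈ same ne with member x∈
    ... | corner _ ey = ey
    ... | inner 1≤j j≤k ei ej with member y∈
    ...   | corner ex _ = ⊥-elim (inner-column 1≤j j≤k (subst (IsEnd n) (trans (sym same) ei) ex))
    ...   | inner 1≤i i≤k fi fj =
      ⊥-elim (ne (trans ej (trans (col-injective 1≤j j≤k 1≤i i≤k (trans (sym ei) (trans same fi))) (sym fj))))

    outermost : ∀ {j} → j ≡ 1 ⊎ 2 + j ≡ m → j ≡ 1 ⊎ j ≡ k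
    outermost (inj₁ e) = inj₁ e
    outermost (inj₂ e) = inj₂ (suc-injective (suc-injective (trans e m≡2+k)))

    corner-inner : ∀ {x : Cell n m} {j} → IsEnd n (ci x) → IsEnd m (cj x) → 1 ≤ j → j ≤ k →
                   ∣ ci x - col j ∣ ≡ 1 → ∣ cj x - j ∣ ≡ 1 → ⊥
    corner-inner {x} {j} ex ey 1≤j j≤k di dj
      with IsEnd-neighbour ey 1≤j (subst (2 + j ≤_) (sym m≡2+k) (s≤s (s≤s j≤k))) dj
         | IsEnd-neighbour ex (col-positive 1≤j j≤k) (col-inner 1≤j j≤k) di
    ... | end-row | inj₁ c≡1   = proj₁ (col-ends (outermost end-row) 1≤j j≤k) c≡1
    ... | end-row | inj₂ c+2≡n = proj₂ (col-ends (outermost end-row) 1≤j j≤k) c+2≡n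

    diagonals : NoDiagonalPair X
    diagonals {x} {y} x∈ y∈ di dj with member x∈ | member y∈
    ... | corner ex _ | corner fx _ = IsEnd-apart 3≤n ex fx di
    ... | corner ex ey | inner 1≤j j≤k fi fj =
      corner-inner {x} ex ey 1≤j j≤k (subst (λ c → ∣ ci x - c ∣ ≡ 1) fi di)
                                     (subst (λ c → ∣ cj x - c ∣ ≡ 1) fj dj)
    ... | inner 1≤j j≤k ei ej | corner fx fy =
      corner-inner {y} fx fy 1≤j j≤k (subst (λ c → ∣ ci y - c ∣ ≡ 1) ei (trans (∣-∣-comm (ci y) (ci x)) di))
                                     (subst (λ c → ∣ cj y - c ∣ ≡ 1) ej (trans (∣-∣-comm (cj y) (cj x)) dj))
    ... | inner {j} 1≤j j≤k ei ej | inner {i} 1≤i i≤k fi fj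
      with ∣m-n∣≡1⇒1+m≡n⊎m≡1+n {j} {i} (subst₂ (λ a b → ∣ a - b ∣ ≡ 1) ej fj dj)
    ...   | inj₁ refl = col-spread 1≤j i≤k (subst₂ (λ a b → ∣ a - b ∣ ≡ 1) ei fi di)
    ...   | inj₂ refl =
      col-spread 1≤i j≤k (trans (∣-∣-comm (col i) (col (suc i))) (subst₂ (λ a b → ∣ a - b ∣ ≡ 1) ei fi di))

    admissible : Admissible X
    admissible = record { rowEnds = rows ; columnEnds = columns ; noDiagonal = diagonals }

    ≢-by-cj : ∀ {x y : Cell n m} → cj x ≢ cj y → x ≢ y
    ≢-by-cj ne refl = ne refl

    0≢n∸1 : 0 ≢ n ∸ 1
    0≢n∸1 e = <-irrefl (trans (cong suc e) (m+[n∸m]≡n 0<n)) (≤-trans (n≤1+n 2) 3≤n)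

    0≢m∸1 : 0 ≢ m ∸ 1
    0≢m∸1 e = 0≢1+n (suc-injective (trans (cong suc e) (trans (m+[n∸m]≡n 0<m) m≡2+k)))

    unique-corners : Unique corners
    unique-corners = (bottom≢top c₀ cₘ ∷ first≢last r₀ rₙ ∷ first≢last r₀ rₙ ∷ [])
                   ∷ (first≢last r₀ rₙ ∷ first≢last r₀ rₙ ∷ []) ∷ (bottom≢top c₀ cₘ ∷ []) ∷ [] ∷ []
      where
      r₀ : toℕ (fromℕ< 0<n) ≡ 0
      r₀ = toℕ-fromℕ< 0<n
      rₙ : toℕ (fromℕ< n∸1<n) ≡ n ∸ 1
      rₙ = toℕ-fromℕ< n∸1<n
      c₀ : toℕ (fromℕ< 0<m) ≡ 0
      c₀ = toℕ-fromℕ< 0<m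
      cₘ : toℕ (fromℕ< m∸1<m) ≡ m ∸ 1
      cₘ = toℕ-fromℕ< m∸1<m
      first≢last : ∀ {x y : Cell n m} → ci x ≡ 0 → ci y ≡ n ∸ 1 → x ≢ y
      first≢last x0 yl refl = 0≢n∸1 (trans (sym x0) yl)
      bottom≢top : ∀ {x y : Cell n m} → cj x ≡ 0 → cj y ≡ m ∸ 1 → x ≢ y
      bottom≢top x0 yl refl = 0≢m∸1 (trans (sym x0) yl)

    unique-points : ∀ j j≤k → Unique (points j j≤k)
    unique-points zero    _   = []
    unique-points (suc j) j≤k = All.tabulate fresh ∷ unique-points j _
      where
      fresh : ∀ {x} → x ∈ points j _ → cell (col (suc j)) (col<n (s≤s z≤n) j≤k) (suc j) (j<m j≤k) ≢ x
      fresh x∈ with ∈-points x∈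
      ... | point _ i≤j _ ej =
        ≢-by-cj (λ e → <-irrefl (sym (trans (sym (toℕ-fromℕ< (j<m j≤k))) (trans e ej))) (s≤s i≤j))

    corner-row : ∀ {x} → x ∈ corners → IsEnd m (cj x)
    corner-row (here refl)                         = inj₁ (toℕ-fromℕ< 0<m)
    corner-row (there (here refl))                 = inj₂ (last-end m∸1<m 0<m)
    corner-row (there (there (here refl)))         = inj₁ (toℕ-fromℕ< 0<m)
    corner-row (there (there (there (here refl)))) = inj₂ (last-end m∸1<m 0<m)

    unique : Unique X
    unique = ++⁺ unique-corners (unique-points k ≤-refl) disjoint
      where
      disjoint : ∀ {x} → ¬ (x ∈ corners × x ∈ points k ≤-refl)
      disjoint (x∈c , x∈p) with ∈-points x∈p
      ... | point 1≤j j≤k _ ej = inner-row 1≤j j≤k (subst (IsEnd m) ej (corner-row x∈c))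

    length-points : ∀ j j≤k → length (points j j≤k) ≡ j
    length-points zero    _ = refl
    length-points (suc j) _ = cong suc (length-points j _)

    length-X : length X ≡ m + 2
    length-X = begin
      4 + length (points k ≤-refl) ≡⟨ cong (4 +_) (length-points k ≤-refl) ⟩
      2 + (2 + k)                  ≡⟨ +-comm 2 (2 + k) ⟩
      (2 + k) + 2                  ≡⟨ cong (_+ 2) (sym m≡2+k) ⟩
      m + 2                        ∎
      where open ≡-Reasoning

corners-and-placement : ∀ {n m k} → 3 ≤ n → m ≡ 2 + k → Placement n k →
                        Σ (List (Cell n m)) λ X → IsOuterMV (Grid n m) X × length X ≡ m + 2
corners-and-placement 3≤n m≡2+k P =
  X , admissible⇒outerMV unique admissible , length-X
  where open CornersAndPlacement 3≤n m≡2+k P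

2+n≰n : ∀ {a} → suc (suc a) ≰ a
2+n≰n h = 1+n≰n (≤-trans (n≤1+n _) h)

m+m≡n+n⇒m≡n : ∀ {a b} → a + a ≡ b + b → a ≡ b
m+m≡n+n⇒m≡n {zero}  {zero}  _ = refl
m+m≡n+n⇒m≡n {suc a} {suc b} e =
  cong suc (m+m≡n+n⇒m≡n (suc-injective (trans (sym (+-suc a a)) (trans (suc-injective e) (+-suc b b)))))

m+m≢1+n+n : ∀ a b → a + a ≢ suc (b + b)
m+m≢1+n+n (suc a) zero    e = 1+n≢0 (trans (sym (+-suc a a)) (suc-injective e))
m+m≢1+n+n (suc a) (suc b) e =
  m+m≢1+n+n a b (suc-injective (trans (sym (+-suc a a)) (trans (suc-injective e) (cong suc (+-suc b b)))))

∣m+m-n+n∣≢1 : ∀ a b → ∣ (a + a) - (b + b) ∣ ≢ 1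
∣m+m-n+n∣≢1 a b e with ∣m-n∣≡1⇒1+m≡n⊎m≡1+n {a + a} {b + b} e
... | inj₁ q = m+m≢1+n+n b a (sym q)
... | inj₂ q = m+m≢1+n+n a b q

⌊n/2⌋+⌊n/2⌋≤n : ∀ k → ⌊ k /2⌋ + ⌊ k /2⌋ ≤ k
⌊n/2⌋+⌊n/2⌋≤n zero          = z≤n
⌊n/2⌋+⌊n/2⌋≤n (suc zero)    = z≤n
⌊n/2⌋+⌊n/2⌋≤n (suc (suc k)) =
  s≤s (subst (_≤ suc k) (sym (+-suc ⌊ k /2⌋ ⌊ k /2⌋)) (s≤s (⌊n/2⌋+⌊n/2⌋≤n k)))

n≤1+⌊n/2⌋+⌊n/2⌋ : ∀ k → k ≤ suc (⌊ k /2⌋ + ⌊ k /2⌋)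
n≤1+⌊n/2⌋+⌊n/2⌋ zero          = z≤n
n≤1+⌊n/2⌋+⌊n/2⌋ (suc zero)    = s≤s z≤n
n≤1+⌊n/2⌋+⌊n/2⌋ (suc (suc k)) =
  s≤s (subst (suc k ≤_) (cong suc (sym (+-suc ⌊ k /2⌋ ⌊ k /2⌋))) (s≤s (n≤1+⌊n/2⌋+⌊n/2⌋ k)))

-- For k ≥ 4 the columns 2, 4, …, 2E, 1, …, 7, 5, 3 (with E = ⌊k/2⌋, odd part descending) work.
module Zigzag (k n : ℕ) (4≤k : 4 ≤ k) (k+2≤n : 2 + k ≤ n) where

  E : ℕ
  E = ⌊ k /2⌋

  2≤E : 2 ≤ E
  2≤E = ⌊n/2⌋-mono 4≤k

  col : ℕ → ℕ
  col j with j ≤? E | j ≟ suc E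
  ... | yes _ | _     = j + j
  ... | no _  | yes _ = 1
  ... | no _  | no _  = suc (suc (k ∸ j) + suc (k ∸ j))

  data Piece (j : ℕ) : ℕ → Set where
    rising  : j ≤ E → Piece j (j + j)
    pivot   : j ≡ suc E → Piece j 1
    falling : ∀ t → j + t ≡ k → suc E < j → Piece j (suc (suc t + suc t))

  piece : ∀ j → j ≤ k → Piece j (col j)
  piece j j≤k with j ≤? E | j ≟ suc E
  ... | yes j≤E | _       = rising j≤E
  ... | no _    | yes j≡  = pivot j≡
  ... | no j≰E  | no j≢   = falling (k ∸ j) (m+[n∸m]≡n j≤k) (≤∧≢⇒< (≰⇒> j≰E) (j≢ ∘ sym))

  E+E≤k : E + E ≤ k
  E+E≤k = ⌊n/2⌋+⌊n/2⌋≤n k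

  6≤n : 6 ≤ n
  6≤n = ≤-trans (s≤s (s≤s 4≤k)) k+2≤n

  falling-short : ∀ {j t} → j + t ≡ k → suc E < j → suc t ≤ E
  falling-short {j} {t} e lt = +-cancelˡ-≤ E (suc t) E
    (subst (_≤ E + E) (sym (+-suc E t))
      (s≤s⁻¹ (≤-trans (+-monoˡ-≤ t lt) (subst (_≤ suc (E + E)) (sym e) (n≤1+⌊n/2⌋+⌊n/2⌋ k)))))

  col-positive : ∀ {j} → 1 ≤ j → j ≤ k → 1 ≤ col j
  col-positive {j} 1≤j j≤k with col j | piece j j≤k
  ... | _ | rising _      = ≤-trans 1≤j (m≤m+n j j)
  ... | _ | pivot _       = ≤-refl
  ... | _ | falling _ _ _ = s≤s z≤n

  col≤k : ∀ {j} → j ≤ k → col j ≤ k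
  col≤k {j} j≤k with col j | piece j j≤k
  ... | _ | rising j≤E     = ≤-trans (+-mono-≤ j≤E j≤E) E+E≤k
  ... | _ | pivot _        = ≤-trans (s≤s z≤n) 4≤k
  ... | _ | falling t e lt = begin
    suc (suc t + suc t) ≡⟨ cong (suc ∘ suc) (+-suc t t) ⟩
    (3 + t) + t         ≤⟨ +-monoˡ-≤ t (≤-trans (s≤s (s≤s (falling-short e lt))) lt) ⟩
    j + t               ≡⟨ e ⟩
    k                   ∎
    where open ≤-Reasoning

  col-injective : ∀ {i j} → 1 ≤ i → i ≤ k → 1 ≤ j → j ≤ k → col i ≡ col j → i ≡ j
  col-injective {i} {j} _ i≤k _ j≤k e with col i | piece i i≤k | col j | piece j j≤k
  ... | _ | rising _         | _ | rising _         = m+m≡n+n⇒m≡n e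
  ... | _ | rising _         | _ | pivot _          = ⊥-elim (m+m≢1+n+n i 0 e)
  ... | _ | rising _         | _ | falling t _ _    = ⊥-elim (m+m≢1+n+n i (suc t) e)
  ... | _ | pivot _          | _ | rising _         = ⊥-elim (m+m≢1+n+n j 0 (sym e))
  ... | _ | pivot p          | _ | pivot q          = trans p (sym q)
  ... | _ | pivot _          | _ | falling _ _ _    = ⊥-elim (0≢1+n (suc-injective e))
  ... | _ | falling t _ _    | _ | rising _         = ⊥-elim (m+m≢1+n+n j (suc t) (sym e))
  ... | _ | falling _ _ _    | _ | pivot _          = ⊥-elim (0≢1+n (suc-injective (sym e)))
  ... | _ | falling t ei _   | _ | falling t′ ej _  =
    +-cancelʳ-≡ t i j (trans ei (trans (sym ej) (cong (j +_) (sym (suc-injective (m+m≡n+n⇒m≡n (suc-injective e)))))))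

  ∣m+m-1∣≢1 : ∀ {a} → 2 ≤ a → ∣ (a + a) - 1 ∣ ≢ 1
  ∣m+m-1∣≢1 {a} 2≤a d with ∣m-n∣≡1⇒1+m≡n⊎m≡1+n {a + a} {1} d
  ... | inj₁ q = <-irrefl (sym (m+n≡0⇒m≡0 a (suc-injective q))) (≤-trans (s≤s z≤n) 2≤a)
  ... | inj₂ q = <-irrefl (sym (m+m≡n+n⇒m≡n {a} {1} q)) 2≤a

  col-spread : ∀ {j} → 1 ≤ j → suc j ≤ k → ∣ col j - col (suc j) ∣ ≢ 1
  col-spread {j} _ j+1≤k with col j | piece j (≤-trans (n≤1+n j) j+1≤k) | col (suc j) | piece (suc j) j+1≤k
  ... | _ | rising _     | _ | rising _       = ∣m+m-n+n∣≢1 j (suc j)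
  ... | _ | rising _     | _ | pivot e        =
    subst (λ a → ∣ (a + a) - 1 ∣ ≢ 1) (sym (suc-injective e)) (∣m+m-1∣≢1 2≤E)
  ... | _ | rising j≤E   | _ | falling _ _ lt = ⊥-elim (<-irrefl refl (≤-trans (s≤s⁻¹ lt) j≤E))
  ... | _ | pivot e      | _ | rising j+1≤E   = ⊥-elim (2+n≰n (subst (λ a → suc a ≤ E) e j+1≤E))
  ... | _ | pivot e      | _ | pivot e′       = ⊥-elim (1+n≢n (trans e′ (sym e)))
  ... | _ | pivot _      | _ | falling t _ _  = ∣m+m-n+n∣≢1 0 (suc t)
  ... | _ | falling _ _ lt | _ | rising j+1≤E = ⊥-elim (2+n≰n (≤-trans (≤-trans lt (n≤1+n j)) j+1≤E))
  ... | _ | falling _ _ lt | _ | pivot e      = ⊥-elim (2+n≰n (subst (suc (suc E) ≤_) (suc-injective e) lt))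
  ... | _ | falling t _ _  | _ | falling t′ _ _ = ∣m+m-n+n∣≢1 (suc t) (suc t′)

  col-ends : ∀ {j} → j ≡ 1 ⊎ j ≡ k → 1 ≤ j → j ≤ k → col j ≢ 1 × 2 + col j ≢ n
  col-ends (inj₁ refl) _ j≤k with col 1 | piece 1 j≤k
  ... | _ | rising _             = (λ ()) , <⇒≢ (≤-trans (n≤1+n 5) 6≤n)
  ... | _ | pivot e              = ⊥-elim (<-irrefl (suc-injective e) (≤-trans (s≤s z≤n) 2≤E))
  ... | _ | falling _ _ (s≤s ())
  col-ends (inj₂ refl) _ k≤k with col k | piece k k≤k
  ... | _ | rising k≤E = ⊥-elim (<-irrefl refl (≤-trans 2≤E
          (+-cancelˡ-≤ E E 1 (≤-trans E+E≤k (≤-trans k≤E (m≤m+n E 1))))))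
  ... | _ | pivot e    = ⊥-elim (<-irrefl refl (≤-trans 2≤E
          (+-cancelˡ-≤ E E 1 (subst (E + E ≤_) (trans e (+-comm 1 E)) E+E≤k))))
  ... | _ | falling t e _ with +-cancelˡ-≡ k t 0 (trans e (sym (+-identityʳ k)))
  ...   | refl = (λ ()) , <⇒≢ 6≤n

  placement : Placement n k
  placement = record
    { col = col ; col-positive = col-positive
    ; col-inner = λ _ j≤k → ≤-trans (s≤s (s≤s (col≤k j≤k))) k+2≤n
    ; col-injective = col-injective ; col-spread = col-spread ; col-ends = col-ends }

placement₀ : ∀ {n} → Placement n 0
placement₀ = record
  { col = λ _ → 0
  ; col-positive = λ { (s≤s z≤n) () } ; col-inner = λ { (s≤s z≤n) () }
  ; col-injective = λ { (s≤s z≤n) () _ _ _ } ; col-spread = λ { (s≤s z≤n) () }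
  ; col-ends = λ { _ (s≤s z≤n) () } }

placement₁ : ∀ {n} → 5 ≤ n → Placement n 1
placement₁ 5≤n = record
  { col = λ _ → 2
  ; col-positive = λ _ _ → s≤s z≤n
  ; col-inner = λ _ _ → ≤-trans (n≤1+n 4) 5≤n
  ; col-injective = λ { (s≤s z≤n) (s≤s z≤n) (s≤s z≤n) (s≤s z≤n) _ → refl }
  ; col-spread = λ { (s≤s z≤n) (s≤s ()) }
  ; col-ends = λ _ _ _ → (λ ()) , <⇒≢ 5≤n }

placement₂ : ∀ {n} → 7 ≤ n → Placement n 2
placement₂ {n} 7≤n = record
  { col = col ; col-positive = positive ; col-inner = inner
  ; col-injective = injective ; col-spread = spread ; col-ends = ends }
  where
  col : ℕ → ℕ
  col 1 = 2
  col _ = 4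
  positive : ∀ {j} → 1 ≤ j → j ≤ 2 → 1 ≤ col j
  positive {1} _ _ = s≤s z≤n
  positive {2} _ _ = s≤s z≤n
  positive {suc (suc (suc _))} _ (s≤s (s≤s ()))
  inner : ∀ {j} → 1 ≤ j → j ≤ 2 → 2 + col j ≤ n
  inner {1} _ _ = ≤-trans (s≤s (s≤s (s≤s (s≤s z≤n)))) 7≤n
  inner {2} _ _ = ≤-trans (n≤1+n 6) 7≤n
  inner {suc (suc (suc _))} _ (s≤s (s≤s ()))
  injective : ∀ {i j} → 1 ≤ i → i ≤ 2 → 1 ≤ j → j ≤ 2 → col i ≡ col j → i ≡ j
  injective {1} {1} _ _ _ _ _ = refl
  injective {2} {2} _ _ _ _ _ = refl
  injective {1} {2} _ _ _ _ ()
  injective {2} {1} _ _ _ _ ()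
  injective {suc (suc (suc _))} _ (s≤s (s≤s ())) _ _ _
  injective {j = suc (suc (suc _))} _ _ _ (s≤s (s≤s ())) _
  spread : ∀ {j} → 1 ≤ j → suc j ≤ 2 → ∣ col j - col (suc j) ∣ ≢ 1
  spread {1} _ _ ()
  ends : ∀ {j} → j ≡ 1 ⊎ j ≡ 2 → 1 ≤ j → j ≤ 2 → col j ≢ 1 × 2 + col j ≢ n
  ends {1} _ _ _ = (λ ()) , <⇒≢ (≤-trans (n≤1+n 5 ) (≤-trans (n≤1+n 6) 7≤n))
  ends {2} _ _ _ = (λ ()) , <⇒≢ 7≤n
  ends {suc (suc (suc _))} _ _ (s≤s (s≤s ()))

placement₃ : ∀ {n} → 7 ≤ n → Placement n 3
placement₃ {n} 7≤n = record
  { col = col ; col-positive = positive ; col-inner = inner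
  ; col-injective = injective ; col-spread = spread ; col-ends = ends }
  where
  col : ℕ → ℕ
  col 1 = 3
  col 2 = 1
  col _ = 4
  positive : ∀ {j} → 1 ≤ j → j ≤ 3 → 1 ≤ col j
  positive {1} _ _ = s≤s z≤n
  positive {2} _ _ = s≤s z≤n
  positive {3} _ _ = s≤s z≤n
  positive {suc (suc (suc (suc _)))} _ (s≤s (s≤s (s≤s ())))
  inner : ∀ {j} → 1 ≤ j → j ≤ 3 → 2 + col j ≤ n
  inner {1} _ _ = ≤-trans (n≤1+n 5) (≤-trans (n≤1+n 6) 7≤n)
  inner {2} _ _ = ≤-trans (s≤s (s≤s (s≤s z≤n))) 7≤n
  inner {3} _ _ = ≤-trans (n≤1+n 6) 7≤n
  inner {suc (suc (suc (suc _)))} _ (s≤s (s≤s (s≤s ())))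
  injective : ∀ {i j} → 1 ≤ i → i ≤ 3 → 1 ≤ j → j ≤ 3 → col i ≡ col j → i ≡ j
  injective {1} {1} _ _ _ _ _ = refl
  injective {2} {2} _ _ _ _ _ = refl
  injective {3} {3} _ _ _ _ _ = refl
  injective {1} {2} _ _ _ _ ()
  injective {1} {3} _ _ _ _ ()
  injective {2} {1} _ _ _ _ ()
  injective {2} {3} _ _ _ _ ()
  injective {3} {1} _ _ _ _ ()
  injective {3} {2} _ _ _ _ ()
  injective {suc (suc (suc (suc _)))} _ (s≤s (s≤s (s≤s ()))) _ _ _
  injective {j = suc (suc (suc (suc _)))} _ _ _ (s≤s (s≤s (s≤s ()))) _
  spread : ∀ {j} → 1 ≤ j → suc j ≤ 3 → ∣ col j - col (suc j) ∣ ≢ 1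
  spread {1} _ _ ()
  spread {2} _ _ ()
  spread {suc (suc (suc _))} _ (s≤s (s≤s (s≤s ())))
  ends : ∀ {j} → j ≡ 1 ⊎ j ≡ 3 → 1 ≤ j → j ≤ 3 → col j ≢ 1 × 2 + col j ≢ n
  ends {1} _ _ _ = (λ ()) , <⇒≢ (≤-trans (n≤1+n 6) 7≤n)
  ends {3} _ _ _ = (λ ()) , <⇒≢ 7≤n
  ends {2} (inj₁ ()) _ _
  ends {2} (inj₂ ()) _ _
  ends {suc (suc (suc (suc _)))} _ _ (s≤s (s≤s (s≤s ())))

-- Small grids by exhaustive search

∨-introˡ : ∀ {x y} → T x → T (x ∨ y)
∨-introˡ t = Equivalence.from T-∨ (inj₁ t)

∨-introʳ : ∀ {x y} → T y → T (x ∨ y)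
∨-introʳ t = Equivalence.from T-∨ (inj₂ t)

∧-intro : ∀ {x y} → T x → T y → T (x ∧ y)
∧-intro s t = Equivalence.from T-∧ (s , t)

moves : ℕ → ℕ → ℕ → ℕ → List (Bool × ℕ × ℕ)
moves a b c d =
  ((a <ᵇ c) , suc a , b) ∷ ((c <ᵇ a) , pred a , b) ∷ ((b <ᵇ d) , a , suc b) ∷ ((d <ᵇ b) , a , pred b) ∷ []

reach : (ℕ → ℕ → Bool) → ℕ → ℕ → ℕ → ℕ → ℕ → Bool
try-move : (ℕ → ℕ → Bool) → ℕ → ℕ → ℕ → Bool × ℕ × ℕ → Bool

reach blocked zero    a b c d = (a ≡ᵇ c) ∧ (b ≡ᵇ d)
reach blocked (suc f) a b c d = any (try-move blocked f c d) (moves a b c d)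

try-move blocked f c d (towards , x , y) =
  towards ∧ (((x ≡ᵇ c) ∧ (y ≡ᵇ d)) ∨ not (blocked x y)) ∧ reach blocked f x y c d

module _ {n m : ℕ} (blocked : ℕ → ℕ → Bool) where

  Free : Cell n m → Cell n m → Set
  Free v x = x ≡ v ⊎ T (not (blocked (ci x) (cj x)))

  dist≤len-from : ∀ {w v x} (q : Walk (Grid n m) w v) → x ∈ vertices q → dist x v ≤ len q
  dist≤len-from {w} []      (here refl) = dist≤len {u = w} {v = w} []
  dist≤len-from {w} {v} (e ∷ q) (here refl) = dist≤len {u = w} {v = v} (e ∷ q)
  dist≤len-from (_ ∷ q) (there x∈)  = m≤n⇒m≤1+n (dist≤len-from q x∈)

  reach-complete : ∀ {u v} (p : Walk (Grid n m) u v) → len p ≡ dist u v →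
                   (∀ x → x ∈ vertices p → x ≢ u → Free v x) →
                   T (reach blocked (dist u v) (ci u) (cj u) (ci v) (cj v))
  reach-complete {u} [] _ _ =
    subst (λ f → T (reach blocked f (ci u) (cj u) (ci u) (cj u))) (sym (dist-self u))
          (∧-intro (≡⇒≡ᵇ (ci u) (ci u) refl) (≡⇒≡ᵇ (cj u) (cj u) refl))
  reach-complete {u} {v} (_∷_ {w = w} e q) l free
    with geodesic-tail {u = u} {w = w} {v = v} e q l
  ... | closer , l′ = subst (λ f → T (reach blocked f (ci u) (cj u) (ci v) (cj v))) closer
                        (any⁺ _ (towards (geodesicStep e closer)))
    where
    rest : T (reach blocked (dist w v) (ci w) (cj w) (ci v) (cj v))
    rest = reach-complete q l′ λ x x∈q _ → free x (there x∈q) λ { refl →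
      1+n≰n (subst (_≤ dist w v) (sym closer) (subst (dist u v ≤_) l′ (dist≤len-from q x∈q))) }
    free-w : T (((ci w ≡ᵇ ci v) ∧ (cj w ≡ᵇ cj v)) ∨ not (blocked (ci w) (cj w)))
    free-w with free w (there (head∈vertices q)) (λ { refl → 0≢1+n (trans (sym (dist-self u)) e) })
    ... | inj₁ refl = ∨-introˡ (∧-intro (≡⇒≡ᵇ (ci w) (ci w) refl) (≡⇒≡ᵇ (cj w) (cj w) refl))
    ... | inj₂ t    = ∨-introʳ t
    move : ∀ {ok x y} → T ok → x ≡ ci w → y ≡ cj w → T (try-move blocked (dist w v) (ci v) (cj v) (ok , x , y))
    move ok refl refl = ∧-intro ok (∧-intro free-w rest)
    towards : GeodesicStep u v w →
              Any (T ∘ try-move blocked (dist w v) (ci v) (cj v)) (moves (ci u) (cj u) (ci v) (cj v))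
    towards (i+ lt p q) = here (move (<⇒<ᵇ lt) p q)
    towards (i- lt p q) = there (here (move (<⇒<ᵇ lt) (cong pred p) q))
    towards (j+ lt p q) = there (there (here (move (<⇒<ᵇ lt) p q)))
    towards (j- lt p q) = there (there (there (here (move (<⇒<ᵇ lt) p (cong pred q)))))

data RowShape (n : ℕ) : Set where
  empty  : RowShape n
  single : Fin n → RowShape n
  ends   : RowShape n

shapes : ∀ n → List (RowShape n)
shapes n = empty ∷ ends ∷ map single (allFin n)

∈-shapes : ∀ {n} (s : RowShape n) → s ∈ shapes n
∈-shapes empty      = here refl
∈-shapes ends       = there (here refl)
∈-shapes (single i) = there (there (∈-map⁺ single (∈-allFin i)))

every : ∀ {n m} → (Vec (RowShape n) m → Bool) → Bool
every {m = zero}  f = f []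
every {n} {suc m} f = all (λ s → every (λ P → f (s ∷ P))) (shapes n)

every-sound : ∀ {n m} (f : Vec (RowShape n) m → Bool) → T (every f) → ∀ P → T (f P)
every-sound {m = zero}  f t []      = t
every-sound {n} {suc m} f t (s ∷ P) =
  every-sound (λ P → f (s ∷ P)) (All.lookup (all⁺ (λ s → every (λ P → f (s ∷ P))) (shapes n) t) (∈-shapes s)) P

T-∨-not : ∀ {b c} → T (b ∨ not c) → T c → T b
T-∨-not {true}         _ _ = _
T-∨-not {false} {true} b _ = b

module _ {n m : ℕ} where

  row-cells : RowShape (suc n) → Fin m → List (Cell (suc n) m)
  row-cells empty      j = []
  row-cells (single i) j = (i , j) ∷ []
  row-cells ends       j = (Fin.zero , j) ∷ (Fin.fromℕ n , j) ∷ []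

  row-cells-row : ∀ {s j x} → x ∈ row-cells s j → proj₂ x ≡ j
  row-cells-row {single _} (here refl)         = refl
  row-cells-row {ends}     (here refl)         = refl
  row-cells-row {ends}     (there (here refl)) = refl

  cells : Vec (RowShape (suc n)) m → List (Cell (suc n) m)
  cells P = concatMap (λ j → row-cells (lookup P j) j) (allFin m)

  ∈-cells⁺ : ∀ P {x} → x ∈ row-cells (lookup P (proj₂ x)) (proj₂ x) → x ∈ cells P
  ∈-cells⁺ P {x} x∈ =
    ∈-concatMap⁺ (λ j → row-cells (lookup P j) j) (Any.map (λ { refl → x∈ }) (∈-allFin (proj₂ x)))

  ∈-cells⁻ : ∀ P {x} → x ∈ cells P → x ∈ row-cells (lookup P (proj₂ x)) (proj₂ x)
  ∈-cells⁻ P x∈ with Any.satisfied (∈-concatMap⁻ (λ j → row-cells (lookup P j) j) {xs = allFin m} x∈)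
  ... | j , x∈row with row-cells-row x∈row
  ...   | refl = x∈row

  has : RowShape (suc n) → ℕ → Bool
  has empty      a = false
  has (single i) a = toℕ i ≡ᵇ a
  has ends       a = (a ≡ᵇ 0) ∨ (a ≡ᵇ n)

  has-sound : ∀ s (i : Fin (suc n)) j → T (has s (toℕ i)) → (i , j) ∈ row-cells s j
  has-sound (single i′) i j t with toℕ-injective (≡ᵇ⇒≡ (toℕ i′) (toℕ i) t)
  ... | refl = here refl
  has-sound ends i j t with Equivalence.to T-∨ t
  ... | inj₁ i≡0 = here (cong (_, j) (toℕ-injective (≡ᵇ⇒≡ (toℕ i) 0 i≡0)))
  ... | inj₂ i≡n = there (here (cong (_, j) (toℕ-injective (trans (≡ᵇ⇒≡ (toℕ i) n i≡n) (sym (toℕ-fromℕ n))))))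

  occupied : ∀ {k} → Vec (RowShape (suc n)) k → ℕ → ℕ → Bool
  occupied []      a _       = false
  occupied (s ∷ _) a zero    = has s a
  occupied (_ ∷ P) a (suc b) = occupied P a b

  occupied-lookup : ∀ {k} (P : Vec (RowShape (suc n)) k) a j → occupied P a (toℕ j) ≡ has (lookup P j) a
  occupied-lookup (s ∷ P) a Fin.zero    = refl
  occupied-lookup (s ∷ P) a (Fin.suc j) = occupied-lookup P a j

  occupied-sound : ∀ P (w : Cell (suc n) m) → T (occupied P (ci w) (cj w)) → w ∈ cells P
  occupied-sound P (i , j) t =
    ∈-cells⁺ P (has-sound (lookup P j) i j (subst T (occupied-lookup P (toℕ i) j) t))

  all-cells : List (Cell (suc n) m)
  all-cells = cartesianProduct (allFin (suc n)) (allFin m)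

  sees : Vec (RowShape (suc n)) m → Cell (suc n) m → Cell (suc n) m → Bool
  sees P u v = reach (occupied P) (dist u v) (ci u) (cj u) (ci v) (cj v)

  sees-all : Vec (RowShape (suc n)) m → Bool
  sees-all P = all (λ u → all (sees P u) all-cells) (cells P)

  within : ℕ → Vec (RowShape (suc n)) m → Bool
  within k P = (length (cells P) ≤ᵇ k) ∨ not (sees-all P)

  -- The shape of each row of X; by RowEnds it determines the cells of X in that row.
  module Profile (X : List (Cell (suc n) m)) (rows : RowEnds X) where

    row-first row-last : Fin m → Cell (suc n) m
    row-first j = Fin.zero , j
    row-last  j = Fin.fromℕ n , j

    data Shape (j : Fin m) : RowShape (suc n) → Set where
      ends   : row-first j ∈ X → row-last j ∈ X → Shape j ends
      single : ∀ i → (i , j) ∈ X → ¬ (row-first j ∈ X × row-last j ∈ X) → Shape j (single i)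
      empty  : (∀ i → (i , j) ∉ X) → Shape j empty

    shape : ∀ j → Σ (RowShape (suc n)) (Shape j)
    shape j with row-first j ∈? X | row-last j ∈? X | any? (λ i → (i , j) ∈? X)
    ... | yes f∈ | yes l∈ | _            = ends , ends f∈ l∈
    ... | yes _  | no l∉  | yes (i , i∈) = single i , single i i∈ (l∉ ∘ proj₂)
    ... | no f∉  | _      | yes (i , i∈) = single i , single i i∈ (f∉ ∘ proj₁)
    ... | yes _  | no _   | no none      = empty , empty (λ i i∈ → none (i , i∈))
    ... | no _   | _      | no none      = empty , empty (λ i i∈ → none (i , i∈))

    profile : Vec (RowShape (suc n)) m
    profile = tabulate (proj₁ ∘ shape)

    row-cells-profile : ∀ j → row-cells (lookup profile j) j ≡ row-cells (proj₁ (shape j)) j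
    row-cells-profile j = cong (λ s → row-cells s j) (lookup∘tabulate (proj₁ ∘ shape) j)

    shape-⊆ : ∀ {j s x} → Shape j s → x ∈ row-cells s j → x ∈ X
    shape-⊆ (ends f∈ _)     (here refl)         = f∈
    shape-⊆ (ends _ l∈)     (there (here refl)) = l∈
    shape-⊆ (single _ i∈ _) (here refl)         = i∈

    at-first : ∀ {x} → ci x ≡ 0 → x ∈ X → row-first (proj₂ x) ∈ X
    at-first x0 x∈ = subst (_∈ X) (cell-ext x0 refl) x∈

    at-last : ∀ {x} → suc (ci x) ≡ suc n → x ∈ X → row-last (proj₂ x) ∈ X
    at-last xl x∈ = subst (_∈ X) (cell-ext (trans (suc-injective xl) (sym (toℕ-fromℕ n))) refl) x∈

    shape-⊇ : ∀ {x s} → x ∈ X → Shape (proj₂ x) s → x ∈ row-cells s (proj₂ x)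
    shape-⊇ {x} x∈ (ends f∈ _) with ci x ≟ 0
    ... | yes x≡0 = here (cell-ext x≡0 refl)
    ... | no x≢0 with rows x∈ f∈ refl x≢0
    ...   | inj₁ x≡0  = ⊥-elim (x≢0 x≡0)
    ...   | inj₂ xl = there (here (cell-ext (trans (suc-injective xl) (sym (toℕ-fromℕ n))) refl))
    shape-⊇ {x} x∈ (single i i∈ ¬both) with proj₁ x Fin.≟ i
    ... | yes refl = here refl
    ... | no x≢i with rows x∈ i∈ refl (x≢i ∘ toℕ-injective) | rows i∈ x∈ refl (x≢i ∘ sym ∘ toℕ-injective)
    ...   | inj₁ x0 | inj₁ i0 = ⊥-elim (x≢i (toℕ-injective (trans x0 (sym i0))))
    ...   | inj₂ xl | inj₂ il = ⊥-elim (x≢i (toℕ-injective (suc-injective (trans xl (sym il)))))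
    ...   | inj₁ x0 | inj₂ il = ⊥-elim (¬both (at-first x0 x∈ , at-last il i∈))
    ...   | inj₂ xl | inj₁ i0 = ⊥-elim (¬both (at-first i0 i∈ , at-last xl x∈))
    shape-⊇ {x} x∈ (empty none) = ⊥-elim (none (proj₁ x) x∈)

    cells-⊆ : ∀ {x} → x ∈ cells profile → x ∈ X
    cells-⊆ {x} x∈ =
      shape-⊆ (proj₂ (shape (proj₂ x))) (subst (x ∈_) (row-cells-profile (proj₂ x)) (∈-cells⁻ profile x∈))

    cells-⊇ : ∀ {x} → x ∈ X → x ∈ cells profile
    cells-⊇ {x} x∈ =
      ∈-cells⁺ profile (subst (x ∈_) (sym (row-cells-profile (proj₂ x))) (shape-⊇ x∈ (proj₂ (shape (proj₂ x)))))

  outerMV-length≤-by-profiles : ∀ k → T (every (within k)) → ∀ {X} → IsOuterMV (Grid (suc n) m) X → length X ≤ k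
  outerMV-length≤-by-profiles k t {X} O =
    ≤-trans (Unique-⊆⇒length≤ (proj₁ O) cells-⊇)
            (≤ᵇ⇒≤ _ k (T-∨-not (every-sound (within k) t profile) sees-profile))
    where
    clear : AllClear X
    clear = outerMV⇒allClear O
    open Profile X (allClear⇒rowEnds clear)
    seen : ∀ {u} → u ∈ cells profile → ∀ v → T (sees profile u v)
    seen {u} u∈ v with clear (cells-⊆ u∈) v
    ... | p , l , clr = reach-complete (occupied profile) p l free
      where
      free : ∀ x → x ∈ vertices p → x ≢ u → Free (occupied profile) v x
      free x x∈p x≢u with occupied profile (ci x) (cj x) in eq
      ... | false = inj₂ _
      ... | true with clr x x∈p (cells-⊆ (occupied-sound profile x (subst T (sym eq) _)))
      ...   | inj₁ x≡u = ⊥-elim (x≢u x≡u)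
      ...   | inj₂ x≡v = inj₁ x≡v
    sees-profile : T (sees-all profile)
    sees-profile = all⁻ (λ u → all (sees profile u) all-cells)
      (All.tabulate λ {u} u∈ → all⁻ (sees profile u) {all-cells} (All.tabulate λ {v} _ → seen u∈ v))

T-⇒ : ∀ {a b} → T (not a ∨ b) → T a → T b
T-⇒ {true} t _ = t

end? : ℕ → ℕ → Bool
end? N a = (a ≡ᵇ 0) ∨ (suc a ≡ᵇ N)

same-or-end : ∀ {N a b} → T ((a ≡ᵇ b) ∨ end? N a) → a ≢ b → IsEnd N a
same-or-end {N} {a} {b} t a≢b with Equivalence.to T-∨ t
... | inj₁ same = ⊥-elim (a≢b (≡ᵇ⇒≡ a b same))
... | inj₂ end with Equivalence.to T-∨ end
...   | inj₁ first = inj₁ (≡ᵇ⇒≡ a 0 first)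
...   | inj₂ last  = inj₂ (≡ᵇ⇒≡ (suc a) N last)

module _ {n m : ℕ} where

  row-ok column-ok diagonal-ok : Cell n m → Cell n m → Bool
  row-ok      x y = not (cj x ≡ᵇ cj y) ∨ (ci x ≡ᵇ ci y) ∨ end? n (ci x)
  column-ok   x y = not (ci x ≡ᵇ ci y) ∨ (cj x ≡ᵇ cj y) ∨ end? m (cj x)
  diagonal-ok x y = not ((∣ ci x - ci y ∣ ≡ᵇ 1) ∧ (∣ cj x - cj y ∣ ≡ᵇ 1))

  admissible-pair : Cell n m → Cell n m → Bool
  admissible-pair x y = row-ok x y ∧ column-ok x y ∧ diagonal-ok x y

  admissible? : List (Cell n m) → Bool
  admissible? X = all (λ x → all (admissible-pair x) X) X

  admissible?-sound : ∀ X → T (admissible? X) → Admissible X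
  admissible?-sound X t = record
    { rowEnds    = λ {x} {y} x∈ y∈ same ne →
        same-or-end (T-⇒ (proj₁ (parts x∈ y∈)) (≡⇒≡ᵇ (cj x) (cj y) same)) ne
    ; columnEnds = λ {x} {y} x∈ y∈ same ne →
        same-or-end (T-⇒ (proj₁ (proj₂ (parts x∈ y∈))) (≡⇒≡ᵇ (ci x) (ci y) same)) ne
    ; noDiagonal = λ x∈ y∈ di dj → not-both (proj₂ (proj₂ (parts x∈ y∈))) (≡⇒≡ᵇ _ 1 di) (≡⇒≡ᵇ _ 1 dj) }
    where
    parts : ∀ {x y} → x ∈ X → y ∈ X → T (row-ok x y) × T (column-ok x y) × T (diagonal-ok x y)
    parts {x} {y} x∈ y∈ with Equivalence.to (T-∧ {row-ok x y}) (All.lookup (all⁺ (admissible-pair x) X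
                                (All.lookup (all⁺ (λ x → all (admissible-pair x) X) X t) x∈)) y∈)
    ... | r , cd = r , Equivalence.to (T-∧ {column-ok x y}) cd
    not-both : ∀ {a b} → T (not (a ∧ b)) → T a → T b → ⊥
    not-both {true} {true} ()

corners-and : ∀ {n m} → List (Cell (suc n) (suc m)) → List (Cell (suc n) (suc m))
corners-and X =
  (Fin.zero , Fin.zero) ∷ (Fin.zero , Fin.fromℕ _) ∷ (Fin.fromℕ _ , Fin.zero) ∷ (Fin.fromℕ _ , Fin.fromℕ _) ∷ X

module _ {n m : ℕ} where
  open import Data.List.Relation.Unary.Unique.DecPropositional (_≟ᶜ_ {suc n} {m}) using (unique?)

  outerMV-by-search : ∀ k (X : List (Cell (suc n) m)) → T (every (within {n} {m} k)) → T (admissible? X) →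
                  True (unique? X) → length X ≡ k → OuterMVNumber (Grid (suc n) m) k
  outerMV-by-search k X bound A U l =
    (X , admissible⇒outerMV (toWitness U) (admissible?-sound X A) , l) , λ _ → outerMV-length≤-by-profiles k bound

outerMV-placement : ∀ {n m k} → 3 ≤ n → m ≡ 2 + k → Placement n k → OuterMVNumber (Grid n m) (m + 2)
outerMV-placement 3≤n m≡2+k P = corners-and-placement 3≤n m≡2+k P , λ _ → outerMV-length≤

two-rows : ∀ n → OuterMVNumber (Grid (3 + n) 2) 4
two-rows n = outerMV-placement (m≤m+n 3 n) refl placement₀

three-rows : ∀ n → OuterMVNumber (Grid (5 + n) 3) 5
three-rows n = outerMV-placement (m≤m+n 3 (2 + n)) refl (placement₁ (m≤m+n 5 n))

four-rows : ∀ n → OuterMVNumber (Grid (7 + n) 4) 6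
four-rows n = outerMV-placement (m≤m+n 3 (4 + n)) refl (placement₂ (m≤m+n 7 n))

five-rows : ∀ n → OuterMVNumber (Grid (7 + n) 5) 7
five-rows n = outerMV-placement (m≤m+n 3 (4 + n)) refl (placement₃ (m≤m+n 7 n))

many-rows : ∀ {n m} → 6 ≤ m → m ≤ n → OuterMVNumber (Grid n m) (m + 2)
many-rows {n} {m} 6≤m m≤n = outerMV-placement (≤-trans (≤-trans (m≤m+n 3 3) 6≤m) m≤n) m≡2+k
  (Zigzag.placement (m ∸ 2) n (∸-monoˡ-≤ 2 6≤m) (subst (_≤ n) m≡2+k m≤n))
  where
  m≡2+k : m ≡ 2 + (m ∸ 2)
  m≡2+k = sym (m+[n∸m]≡n (≤-trans (m≤m+n 2 4) 6≤m))

theorem4p3 : ∀ (n m : ℕ) → 2 ≤ m → m ≤ n →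
    OuterMVNumber (Grid n m) (muoGrid n m)
theorem4p3 _ 0 () _
theorem4p3 _ 1 (s≤s ()) _
theorem4p3 0 (suc (suc _)) _ ()
theorem4p3 1 (suc (suc _)) _ (s≤s ())
theorem4p3 2 2 _ _ = outerMV-by-search 2 ((# 0 , # 0) ∷ (# 1 , # 0) ∷ []) _ _ _ refl
theorem4p3 2 (suc (suc (suc _))) _ (s≤s (s≤s ()))
theorem4p3 3 2 _ _ = two-rows 0
theorem4p3 3 3 _ _ = outerMV-by-search 4 (corners-and []) _ _ _ refl
theorem4p3 3 (suc (suc (suc (suc _)))) _ (s≤s (s≤s (s≤s ())))
theorem4p3 4 2 _ _ = two-rows 1
theorem4p3 4 3 _ _ = outerMV-by-search 4 (corners-and []) _ _ _ refl
theorem4p3 4 4 _ _ = outerMV-by-search 4 (corners-and []) _ _ _ refl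
theorem4p3 4 (suc (suc (suc (suc (suc _))))) _ (s≤s (s≤s (s≤s (s≤s ()))))
theorem4p3 5 2 _ _ = two-rows 2
theorem4p3 5 3 _ _ = three-rows 0
theorem4p3 5 4 _ _ = outerMV-by-search 5 (corners-and ((# 2 , # 1) ∷ [])) _ _ _ refl
theorem4p3 5 5 _ _ = outerMV-by-search 5 (corners-and ((# 2 , # 1) ∷ [])) _ _ _ refl
theorem4p3 5 (suc (suc (suc (suc (suc (suc _)))))) _ (s≤s (s≤s (s≤s (s≤s (s≤s ())))))
theorem4p3 6 2 _ _ = two-rows 3
theorem4p3 6 3 _ _ = three-rows 1
theorem4p3 6 4 _ _ = outerMV-by-search 5 (corners-and ((# 2 , # 1) ∷ [])) _ _ _ refl
theorem4p3 6 5 _ _ = outerMV-by-search 6 (corners-and ((# 2 , # 1) ∷ (# 3 , # 3) ∷ [])) _ _ _ refl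
theorem4p3 6 6 _ m≤n = many-rows ≤-refl m≤n
theorem4p3 6 (suc (suc (suc (suc (suc (suc (suc _))))))) _ (s≤s (s≤s (s≤s (s≤s (s≤s (s≤s ()))))))
theorem4p3 (suc (suc (suc (suc (suc (suc (suc n))))))) 2 _ _ = two-rows (4 + n)
theorem4p3 (suc (suc (suc (suc (suc (suc (suc n))))))) 3 _ _ = three-rows (2 + n)
theorem4p3 (suc (suc (suc (suc (suc (suc (suc n))))))) 4 _ _ = four-rows n
theorem4p3 (suc (suc (suc (suc (suc (suc (suc n))))))) 5 _ _ = five-rows n
theorem4p3 (suc (suc (suc (suc (suc (suc (suc n))))))) m@(suc (suc (suc (suc (suc (suc _)))))) _ m≤n =
  many-rows (m≤m+n 6 _) m≤n
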